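{- Let $\mathcal{M}$ be a matroid on a finite set $E$ with rank function $\rk$, let $m:2^E\to\mathbb{R}$ be arbitrary, and let $[R,S]$ be a molecule with $S=R\cup F\cup T$ (disjoint union) as in the definition. Then $$\sum_{A\in[R,S]} m(A)q^{ -\rk(A)}\prod_{e\in A}v_e = q^{ -\rk(S)}\Big(\prod_{e\in R\cup F}v_e\Big)\sum_{K\subseteq F,\,L\subseteq T}\rho(R\cup L,S\setminus K)\prod_{e\in K}\Big(\frac{q}{v_e}+1\Big)\prod_{e\in L}(v_e+1).$$ Moreover, if $(\mathcal{M},m)$ is a quasi-arithmetic matroid, then $$\sum_{A\in[R,S]} m(A)q^{ -\rk(A)}\prod_{e\in A}v_e = q^{ -\rk(S)}\Big(\prod_{e\in R\cup F}v_e\Big)\Big(\sum_{K\subseteq F}\frac{\rho(R,R\cup(F\setminus K))}{m(R)}\prod_{e\in K}\Big(\frac{q}{v_e}+1\Big)\Big)\Big(\sum_{L\subseteq T}\rho(R\cup L,R\cup T)\prod_{e\in L}(v_e+1)\Big),$$ and each $\rho(R,R\cup(F\setminus K))/m(R)$ is an integer.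
   Context: A matroid on a finite set $E$ is given by a rank function $\rk:2^E\to\mathbb{N}$ with $\rk(\emptyset)=0$, monotone, and submodular. For $R\subseteq S\subseteq E$ let $[R,S]=\{A:R\subseteq A\subseteq S\}$. $[R,S]$ is a molecule if $S$ is a disjoint union $S=R\cup F\cup T$ such that $\rk(A)=\rk(R)+|A\cap F|$ for all $A\in[R,S]$ (then $F,T$ are determined: $F$ consists of the $e\in S\setminus R$ with $\rk(R\cup\{e\})=\rk(R)+1$). Every subinterval of a molecule is a molecule; in particular $[R\cup L,S\setminus K]$ is a molecule with parts $F\setminus K$, $T\setminus L$. For a molecule $[R,S]$ with parts $F,T$, $\rho(R,S):=(-1)^{|T|}\sum_{A\in[R,S]}(-1)^{|S|-|A|}m(A)$. A quasi-arithmetic matroid is a matroid with $m:2^E\to\mathbb{N}$ such that (A1) for all $A\subseteq E$, $e\in E$: if $\rk(A\cup\{e\})=\rk(A)$ then $m(A\cup\{e\})$ divides $m(A)$, otherwise $m(A)$ divides $m(A\cup\{e\})$; and (A2) for every molecule $[R,S]$ with parts $F,T$, $m(R)m(S)=m(R\cup F)m(R\cup T)$. -}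

module Defs where

open import Level using (Level)
open import Data.Nat as ℕ using (ℕ; zero; suc; _≤_; _∸_)
open import Data.Bool using (true; false; if_then_else_; _∧_; not)
open import Data.Vec using ([]; _∷_; tabulate)
open import Data.List using (List; []; _∷_; map; filter; _++_; foldr; allFin)
open import Data.Fin using (Fin)
open import Data.Fin.Subset using (Subset; _∪_; _∩_; _⊆_; ∣_∣; ⁅_⁆; _─_)
  renaming (⊥ to ∅)
open import Data.Fin.Subset.Properties using (_⊆?_; _∈?_)
open import Data.Product using (_×_)
open import Relation.Nullary.Decidable using (⌊_⌋; _×-dec_)
open import Relation.Binary.PropositionalEquality using (_≡_)
open import Algebra.Bundles using (CommutativeRing)
open import Data.Integer using (ℤ; +_; -[1+_])

record Matroid (n : ℕ) : Set where
  field
    rk        : Subset n → ℕ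
    rk-∅      : rk ∅ ≡ 0
    rk-mono   : ∀ {A B} → A ⊆ B → rk A ≤ rk B
    rk-submod : ∀ A B → rk (A ∪ B) ℕ.+ rk (A ∩ B) ≤ rk A ℕ.+ rk B

allSubsets : (n : ℕ) → List (Subset n)
allSubsets zero    = [] ∷ []
allSubsets (suc n) = map (false ∷_) (allSubsets n) ++ map (true ∷_) (allSubsets n)

interval : ∀ {n} → Subset n → Subset n → List (Subset n)
interval R S = filter (λ A → (R ⊆? A) ×-dec (A ⊆? S)) (allSubsets _)

IsMolecule : ∀ {n} → (Subset n → ℕ) → (R S F T : Subset n) → Set
IsMolecule rk R S F T =
  (R ∩ F ≡ ∅) × (R ∩ T ≡ ∅) × (F ∩ T ≡ ∅) × (S ≡ (R ∪ F) ∪ T) ×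
  (∀ A → R ⊆ A → A ⊆ S → rk A ≡ rk R ℕ.+ ∣ A ∩ F ∣)

-- The part T of [R,S], determined by R and S: the e ∈ S \ R with
-- rk(R ∪ {e}) = rk(R)  (i.e. S \ R minus the part F).
tPart : ∀ {n} → (Subset n → ℕ) → Subset n → Subset n → Subset n
tPart rk R S = tabulate λ e →
  ⌊ e ∈? S ⌋ ∧ not ⌊ e ∈? R ⌋ ∧ not ⌊ rk (R ∪ ⁅ e ⁆) ℕ.≟ suc (rk R) ⌋

module RingOps {c ℓ : Level} (K : CommutativeRing c ℓ) where
  open CommutativeRing K

  sumL : ∀ {a} {X : Set a} → List X → (X → Carrier) → Carrier
  sumL xs f = foldr (λ x acc → f x + acc) 0# xs

  prodOver : ∀ {n} → Subset n → (Fin n → Carrier) → Carrier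
  prodOver A f = foldr (λ e acc → (if ⌊ e ∈? A ⌋ then f e else 1#) * acc) 1# (allFin _)

  pow : Carrier → ℕ → Carrier
  pow x zero    = 1#
  pow x (suc k) = x * pow x k

  sign : ℕ → Carrier
  sign k = pow (- 1#) k

  ιℕ : ℕ → Carrier
  ιℕ zero    = 0#
  ιℕ (suc k) = 1# + ιℕ k

  ιℤ : ℤ → Carrier
  ιℤ (+ k)     = ιℕ k
  ιℤ -[1+ k ]  = - ιℕ (suc k)

  ρ : ∀ {n} → (Subset n → ℕ) → (Subset n → Carrier) → Subset n → Subset n → Carrier
  ρ rk m R S = sign ∣ tPart rk R S ∣ * sumL (interval R S) (λ A → sign (∣ S ∣ ∸ ∣ A ∣) * m A)

  -- Σ_{A ∈ [R,S]} m(A) q^{-rk A} ∏_{e∈A} v_e, where qi = q⁻¹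
  lhsSum : ∀ {n} → (Subset n → ℕ) → (Subset n → Carrier) → Carrier → (Fin n → Carrier)
           → Subset n → Subset n → Carrier
  lhsSum rk m qi v R S = sumL (interval R S) (λ A → m A * pow qi (rk A) * prodOver A v)

import Data.Integer.Properties as ℤP

ρℤ : ∀ {n} → (Subset n → ℕ) → (Subset n → ℕ) → Subset n → Subset n → ℤ
ρℤ rk m R S = RingOps.ρ ℤP.+-*-commutativeRing rk (λ A → + m A) R S

-- The two identities of the lemma, for a fixed commutative ring K in
-- which q (inverse qi) and the v_e (inverses vi e) are units.

open import Data.Integer.DivMod using (_/ℕ_)
open import Data.Nat using (NonZero)

module Identities {c ℓ : Level} (K : CommutativeRing c ℓ) where
  open CommutativeRing K
  open RingOps K

  Identity₁ : ∀ {n} → (Subset n → ℕ) → (Subset n → Carrier) → (R S F T : Subset n) → Set (c Level.⊔ ℓ)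
  Identity₁ {n} rk m R S F T =
    (q qi : Carrier) (v vi : Fin n → Carrier) →
    q * qi ≈ 1# → (∀ e → v e * vi e ≈ 1#) →
    lhsSum rk m qi v R S
      ≈ pow qi (rk S) * prodOver (R ∪ F) v
        * sumL (interval ∅ F) (λ Kₛ → sumL (interval ∅ T) (λ L →
            ρ rk m (R ∪ L) (S ─ Kₛ)
            * prodOver Kₛ (λ e → q * vi e + 1#)
            * prodOver L (λ e → v e + 1#)))

  Identity₂ : ∀ {n} → (Subset n → ℕ) → (m : Subset n → ℕ) → (R S F T : Subset n) →
              NonZero (m R) → Set (c Level.⊔ ℓ)
  Identity₂ {n} rk m R S F T nz =
    (q qi : Carrier) (v vi : Fin n → Carrier) →
    q * qi ≈ 1# → (∀ e → v e * vi e ≈ 1#) →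
    lhsSum rk (λ A → ιℕ (m A)) qi v R S
      ≈ pow qi (rk S) * prodOver (R ∪ F) v
        * sumL (interval ∅ F) (λ Kₛ →
            ιℤ (_/ℕ_ (ρℤ rk m R (R ∪ (F ─ Kₛ))) (m R) {{nz}})
            * prodOver Kₛ (λ e → q * vi e + 1#))
        * sumL (interval ∅ T) (λ L →
            ιℤ (ρℤ rk m (R ∪ L) (R ∪ T))
            * prodOver L (λ e → v e + 1#))

open import Data.Nat.Divisibility using () renaming (_∣_ to _∣ℕ_)
open import Relation.Nullary using (¬_)

A1 : ∀ {n} → (Subset n → ℕ) → (Subset n → ℕ) → Set
A1 rk m = ∀ A e →
  (rk (A ∪ ⁅ e ⁆) ≡ rk A → m (A ∪ ⁅ e ⁆) ∣ℕ m A) ×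
  (¬ (rk (A ∪ ⁅ e ⁆) ≡ rk A) → m A ∣ℕ m (A ∪ ⁅ e ⁆))

A2 : ∀ {n} → (Subset n → ℕ) → (Subset n → ℕ) → Set
A2 rk m = ∀ R S F T → IsMolecule rk R S F T →
  m R ℕ.* m S ≡ m (R ∪ F) ℕ.* m (R ∪ T)

-- Identify subsets of Fin n with points of the Boolean cube. Every quantity in the lemma is a cube sum of m
-- against a product of coordinate weights: the interval indicators, q^{-rk A} (on the molecule
-- rk A = rk R + |A ∩ F|), the products of the v_e, and ρ on a subinterval [R′, S′] of the molecule, whose
-- T-part is S′ ∖ R′ ∖ F. Since Σ_X ∏ᵢ wᵢ(Xᵢ) = ∏ᵢ (wᵢ(0) + wᵢ(1)), summing out K and L reduces the first identity
-- to a check in a single coordinate, according to whether it lies in R, F, T or outside S; the hypotheses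
-- q q⁻¹ = v_e v_e⁻¹ = 1 are used only there.
--
-- In the quasi-arithmetic case, (A1) along F gives m(R) ∣ m(A) on [R, R ∪ F], hence m(R) ∣ ρ(R, R ∪ (F ∖ K)).
-- (A2) on the molecule [R, A] gives m(R) m(A) = m(R ∪ (A ∩ F)) m(R ∪ (A ∩ T)), and A ↦ (R ∪ (A ∩ F), R ∪ (A ∩ T))
-- acts coordinatewise, so pushing the cube weights of ρ(R ∪ L, S ∖ K) forward along it factorises
-- m(R) ρ(R ∪ L, S ∖ K) = ρ(R, R ∪ (F ∖ K)) ρ(R ∪ L, R ∪ T) in ℤ. Cancelling m(R) and mapping ℤ into the ring
-- turns the first identity into the second.

module Submission where

open import Defs
open import Level using (Level; 0ℓ)
open import Algebra.Bundles using (CommutativeRing)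
import Algebra.Properties.CommutativeMonoid.Sum as MonoidSum
open import Data.Bool using (Bool; true; false; if_then_else_; _∧_; _∨_; not; _≤_; b≤b; f≤t)
open import Data.Bool.Properties
  using (≤-minimum; ≤-maximum; ∧-zeroʳ; ∧-identityʳ) renaming (_≟_ to _≟ᵇ_; _≤?_ to _≤?ᵇ_)
open import Data.Empty using (⊥-elim)
open import Data.Fin as Fin using (Fin)
open import Data.Fin.Subset using (Subset; _∪_; _∩_; _─_; _-_; _⊆_; _⊂_; _∈_; _∉_; ∣_∣; ⁅_⁆) renaming (⊥ to ∅)
open import Data.Fin.Subset.Induction using (⊂-wellFounded)
open import Data.Fin.Subset.Properties
  using (_⊆?_; _∈?_; drop-∷-⊆; p⊆q⇒∣p∣≤∣q∣; nonempty?; ⊆-refl; ⊆-trans; ⊆-antisym; p⊆p∪q; q⊆p∪q; p─q⊆p; p─⊥≡p;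
         x∈p∪q⁻; x∈p∧x∉q⇒x∈p─q; x∈p⇒p-x⊂p; x∈p∧x≢y⇒x∈p-y; x∈⁅x⁆; x∈⁅y⁆⇒x≡y; ∩-assoc; ∪-identityʳ)
open import Data.Integer as ℤ using (ℤ; +_; -[1+_]; 0ℤ; _⊖_)
import Data.Integer.Properties as ℤP
open import Data.Integer.DivMod using (_/ℕ_)
open import Data.Integer.Divisibility using () renaming (_∣_ to _∣ℤ_)
import Data.Integer.Divisibility.Signed as Signed
open import Data.List using (List; []; _∷_; map; filter; _++_)
import Data.List as List
open import Data.Nat as ℕ using (ℕ; zero; suc; _∸_; NonZero)
import Data.Nat.Properties as ℕP
open import Data.Nat.DivMod using (m*n/n≡m; m*n%n≡0)
open import Data.Nat.Divisibility using (∣-refl; ∣-trans) renaming (_∣_ to _∣ℕ_)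
open import Data.Product using (_×_; _,_; proj₁; proj₂)
import Data.Sign as Sign
open import Data.Sum using (inj₁; inj₂)
open import Data.Vec using (_∷_; []; lookup; here; there)
open import Data.Vec.Properties
  using (lookup-zipWith; lookup-replicate; tabulate∘lookup; tabulate-cong; lookup∘tabulate; []=⇒lookup; lookup⇒[]=)
open import Induction.WellFounded using (WfRec; module All)
open import Relation.Binary.PropositionalEquality as ≡ using (_≡_; subst; subst₂; module ≡-Reasoning)
open import Relation.Nullary using (does; _because_; yes; no; ¬_)
open import Relation.Nullary.Decidable using (isYes; ⌊_⌋; _×-dec_; dec-true; dec-false; isYes≗does)
open import Relation.Unary using (Pred; Decidable)

-- Subsets of Fin n as Boolean vectors

isYes-∈? : ∀ {n} (i : Fin n) (A : Subset n) → isYes (i ∈? A) ≡ lookup A i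
isYes-∈? Fin.zero    (true  ∷ A) = ≡.refl
isYes-∈? Fin.zero    (false ∷ A) = ≡.refl
isYes-∈? (Fin.suc i) (_     ∷ A) with i ∈? A | isYes-∈? i A
... | true  because _ | eq = eq
... | false because _ | eq = eq

lookup-─ : ∀ {n} (X Y : Subset n) i → lookup (X ─ Y) i ≡ lookup X i ∧ not (lookup Y i)
lookup-─ (x ∷ X) (true  ∷ Y) Fin.zero    = ≡.sym (∧-zeroʳ x)
lookup-─ (x ∷ X) (false ∷ Y) Fin.zero    = ≡.sym (∧-identityʳ x)
lookup-─ (x ∷ X) (y     ∷ Y) (Fin.suc i) = lookup-─ X Y i

∣─∣ : ∀ {n} {Y A : Subset n} → A ⊆ Y → ∣ Y ∣ ∸ ∣ A ∣ ≡ ∣ Y ─ A ∣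
∣─∣ {Y = []}        {[]}        A⊆Y = ≡.refl
∣─∣ {Y = true  ∷ Y} {true  ∷ A} A⊆Y = ∣─∣ (drop-∷-⊆ A⊆Y)
∣─∣ {Y = true  ∷ Y} {false ∷ A} A⊆Y =
  ≡.trans (ℕP.+-∸-assoc 1 (p⊆q⇒∣p∣≤∣q∣ (drop-∷-⊆ A⊆Y))) (≡.cong suc (∣─∣ (drop-∷-⊆ A⊆Y)))
∣─∣ {Y = false ∷ Y} {false ∷ A} A⊆Y = ∣─∣ (drop-∷-⊆ A⊆Y)
∣─∣ {Y = false ∷ Y} {true  ∷ A} A⊆Y with A⊆Y here
... | ()

≡-lookup : ∀ {n} {X Y : Subset n} → (∀ i → lookup X i ≡ lookup Y i) → X ≡ Y
≡-lookup {X = X} {Y} eq =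
  ≡.trans (≡.sym (tabulate∘lookup X)) (≡.trans (tabulate-cong eq) (tabulate∘lookup Y))

⊆⇒lookup-≤ : ∀ {n} {X Y : Subset n} → X ⊆ Y → ∀ i → lookup X i ≤ lookup Y i
⊆⇒lookup-≤ {X = X} {Y} X⊆Y i with lookup X i in eq
... | false = ≤-minimum _
... | true  = subst (true ≤_) (≡.sym ([]=⇒lookup (X⊆Y (lookup⇒[]= i X eq)))) b≤b

lookup-≤⇒⊆ : ∀ {n} {X Y : Subset n} → (∀ i → lookup X i ≤ lookup Y i) → X ⊆ Y
lookup-≤⇒⊆ {X = X} {Y} X≤Y {i} i∈X =
  lookup⇒[]= i Y (true≤ (subst (_≤ lookup Y i) ([]=⇒lookup i∈X) (X≤Y i)))
  where
  true≤ : ∀ {b} → true ≤ b → b ≡ true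
  true≤ b≤b = ≡.refl

∣∪⁅⁆∩∣ : ∀ {n} (X Y : Subset n) i → lookup X i ≡ false →
         ∣ (X ∪ ⁅ i ⁆) ∩ Y ∣ ≡ (if lookup Y i then suc ∣ X ∩ Y ∣ else ∣ X ∩ Y ∣)
∣∪⁅⁆∩∣ (false ∷ X) (true  ∷ Y) Fin.zero    _  = ≡.cong (λ Z → suc ∣ Z ∩ Y ∣) (∪-identityʳ X)
∣∪⁅⁆∩∣ (false ∷ X) (false ∷ Y) Fin.zero    _  = ≡.cong (λ Z → ∣ Z ∩ Y ∣) (∪-identityʳ X)
∣∪⁅⁆∩∣ (true  ∷ X) _           Fin.zero    ()
∣∪⁅⁆∩∣ (false ∷ X) (y     ∷ Y) (Fin.suc i) eq = ∣∪⁅⁆∩∣ X Y i eq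
∣∪⁅⁆∩∣ (true  ∷ X) (false ∷ Y) (Fin.suc i) eq = ∣∪⁅⁆∩∣ X Y i eq
∣∪⁅⁆∩∣ (true  ∷ X) (true  ∷ Y) (Fin.suc i) eq =
  ≡.trans (≡.cong suc (∣∪⁅⁆∩∣ X Y i eq)) (suc-if (lookup Y i))
  where
  suc-if : ∀ b → suc (if b then suc ∣ X ∩ Y ∣ else ∣ X ∩ Y ∣)
                 ≡ (if b then suc (suc ∣ X ∩ Y ∣) else suc ∣ X ∩ Y ∣)
  suc-if true  = ≡.refl
  suc-if false = ≡.refl

∪-least : ∀ {n} {X Y Z : Subset n} → X ⊆ Z → Y ⊆ Z → X ∪ Y ⊆ Z
∪-least {X = X} {Y} X⊆Z Y⊆Z x∈X∪Y with x∈p∪q⁻ X Y x∈X∪Y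
... | inj₁ x∈X = X⊆Z x∈X
... | inj₂ x∈Y = Y⊆Z x∈Y

lookup-─-∈ : ∀ {n} (p : Subset n) {q x} → x ∈ q → lookup (p ─ q) x ≡ false
lookup-─-∈ p {q} {x} x∈q =
  ≡.trans (lookup-─ p q x) (≡.trans (≡.cong (λ b → lookup p x ∧ not b) ([]=⇒lookup x∈q)) (∧-zeroʳ _))

x∈p─q⇒x∉q : ∀ {n} {x} (p q : Subset n) → x ∈ p ─ q → x ∉ q
x∈p─q⇒x∉q p q x∈p─q x∈q with ≡.trans (≡.sym ([]=⇒lookup x∈p─q)) (lookup-─-∈ p x∈q)
... | ()

p-x∪⁅x⁆≡p : ∀ {n} {p : Subset n} {x} → x ∈ p → (p - x) ∪ ⁅ x ⁆ ≡ p
p-x∪⁅x⁆≡p {p = true  ∷ p} here        = ≡.cong (true ∷_) (≡.trans (∪-identityʳ (p ─ ∅)) (p─⊥≡p p))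
p-x∪⁅x⁆≡p {p = true  ∷ p} (there x∈p) = ≡.cong (true ∷_) (p-x∪⁅x⁆≡p x∈p)
p-x∪⁅x⁆≡p {p = false ∷ p} (there x∈p) = ≡.cong (false ∷_) (p-x∪⁅x⁆≡p x∈p)

⊆⇒∩≡ : ∀ {n} {X Y : Subset n} → X ⊆ Y → X ∩ Y ≡ X
⊆⇒∩≡ {X = X} {Y} X⊆Y =
  ≡-lookup λ i → ≡.trans (lookup-zipWith _∧_ i X Y) (≤⇒∧≡ (⊆⇒lookup-≤ X⊆Y i))
  where
  ≤⇒∧≡ : ∀ {x y} → x ≤ y → x ∧ y ≡ x
  ≤⇒∧≡ f≤t           = ≡.refl
  ≤⇒∧≡ (b≤b {true})  = ≡.refl
  ≤⇒∧≡ (b≤b {false}) = ≡.refl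

-- Finite sums and sums over the Boolean cube

module FiniteSums {c ℓ : Level} (K : CommutativeRing c ℓ) where
  open CommutativeRing K hiding (zero)
  open RingOps K
  open import Relation.Binary.Reasoning.Setoid setoid

  𝟙 : Bool → Carrier
  𝟙 b = if b then 1# else 0#

  module _ {a} {X : Set a} where

    sumL-cong : (xs : List X) {f g : X → Carrier} → (∀ x → f x ≈ g x) → sumL xs f ≈ sumL xs g
    sumL-cong []       f≈g = refl
    sumL-cong (x ∷ xs) f≈g = +-cong (f≈g x) (sumL-cong xs f≈g)

    sumL-++ : (xs ys : List X) (f : X → Carrier) → sumL (xs ++ ys) f ≈ sumL xs f + sumL ys f
    sumL-++ []       ys f = sym (+-identityˡ _)
    sumL-++ (x ∷ xs) ys f = trans (+-congˡ (sumL-++ xs ys f)) (sym (+-assoc _ _ _))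

    sumL-zero : (xs : List X) → sumL xs (λ _ → 0#) ≈ 0#
    sumL-zero []       = refl
    sumL-zero (x ∷ xs) = trans (+-identityˡ _) (sumL-zero xs)

    sumL-+ : (xs : List X) (f g : X → Carrier) → sumL xs (λ x → f x + g x) ≈ sumL xs f + sumL xs g
    sumL-+ []       f g = sym (+-identityˡ 0#)
    sumL-+ (x ∷ xs) f g = begin
      (f x + g x) + sumL xs (λ x → f x + g x) ≈⟨ +-congˡ (sumL-+ xs f g) ⟩
      (f x + g x) + (sumL xs f + sumL xs g)   ≈⟨ +-assoc _ _ _ ⟩
      f x + (g x + (sumL xs f + sumL xs g))   ≈⟨ +-congˡ (+-comm _ _) ⟩
      f x + ((sumL xs f + sumL xs g) + g x)   ≈⟨ +-congˡ (+-assoc _ _ _) ⟩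
      f x + (sumL xs f + (sumL xs g + g x))   ≈⟨ +-congˡ (+-congˡ (+-comm _ _)) ⟩
      f x + (sumL xs f + (g x + sumL xs g))   ≈⟨ +-assoc _ _ _ ⟨
      (f x + sumL xs f) + (g x + sumL xs g)   ∎

    sumL-distribˡ : (k : Carrier) (xs : List X) (f : X → Carrier) → k * sumL xs f ≈ sumL xs (λ x → k * f x)
    sumL-distribˡ k []       f = zeroʳ k
    sumL-distribˡ k (x ∷ xs) f = trans (distribˡ _ _ _) (+-congˡ (sumL-distribˡ k xs f))

    sumL-distribʳ : (k : Carrier) (xs : List X) (f : X → Carrier) → sumL xs f * k ≈ sumL xs (λ x → f x * k)
    sumL-distribʳ k xs f = trans (*-comm _ k) (trans (sumL-distribˡ k xs f) (sumL-cong xs λ x → *-comm k (f x)))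

    sumL-filter : {p : Level} {P : Pred X p} (P? : Decidable P) (xs : List X) (f : X → Carrier) →
                  sumL (filter P? xs) f ≈ sumL xs (λ x → 𝟙 (does (P? x)) * f x)
    sumL-filter P? []       f = refl
    sumL-filter P? (x ∷ xs) f with does (P? x)
    ... | true  = +-cong (sym (*-identityˡ _)) (sumL-filter P? xs f)
    ... | false = trans (sumL-filter P? xs f) (sym (trans (+-congʳ (zeroˡ _)) (+-identityˡ _)))

  sumL-product : ∀ {a b} {X : Set a} {Y : Set b} (xs : List X) (ys : List Y)
                 (f : X → Carrier) (g : Y → Carrier) →
                 sumL xs f * sumL ys g ≈ sumL xs (λ x → sumL ys (λ y → f x * g y))
  sumL-product xs ys f g = trans (sumL-distribʳ _ xs f) (sumL-cong xs λ x → sumL-distribˡ (f x) ys g)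

  sumL-map : ∀ {a b} {X : Set a} {Y : Set b} (g : X → Y) (xs : List X) (f : Y → Carrier) →
             sumL (map g xs) f ≡ sumL xs (λ x → f (g x))
  sumL-map g []       f = ≡.refl
  sumL-map g (x ∷ xs) f = ≡.cong (λ s → f (g x) + s) (sumL-map g xs f)

  sumL-comm : ∀ {a b} {X : Set a} {Y : Set b} (xs : List X) (ys : List Y) (f : X → Y → Carrier) →
              sumL xs (λ x → sumL ys (f x)) ≈ sumL ys (λ y → sumL xs (λ x → f x y))
  sumL-comm []       ys f = sym (sumL-zero ys)
  sumL-comm (x ∷ xs) ys f = trans (+-congˡ (sumL-comm xs ys f)) (sym (sumL-+ ys (f x) _))

module CubeSums {c ℓ : Level} (K : CommutativeRing c ℓ) where
  open CommutativeRing K hiding (zero)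
  open RingOps K
  open FiniteSums K
  open import Relation.Binary.Reasoning.Setoid setoid
  open MonoidSum *-commutativeMonoid public
    using () renaming (sum to ∏; sum-cong-≋ to ∏-cong; ∑-distrib-+ to ∏-distrib)

  ∑ₛ : ∀ {n} → (Subset n → Carrier) → Carrier
  ∑ₛ = sumL (allSubsets _)

  weight : ∀ {n} → (Fin n → Bool → Carrier) → Subset n → Carrier
  weight w A = ∏ (λ i → w i (lookup A i))

  ∑ₛ-cong : ∀ {n} {f g : Subset n → Carrier} → (∀ A → f A ≈ g A) → ∑ₛ f ≈ ∑ₛ g
  ∑ₛ-cong = sumL-cong (allSubsets _)

  ∑ₛ-suc : ∀ {n} (f : Subset (suc n) → Carrier) →
           ∑ₛ f ≈ ∑ₛ (λ A → f (false ∷ A)) + ∑ₛ (λ A → f (true ∷ A))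
  ∑ₛ-suc {n} f = trans (sumL-++ (map (false ∷_) (allSubsets n)) _ f)
    (+-cong (reflexive (sumL-map _ (allSubsets n) f)) (reflexive (sumL-map _ (allSubsets n) f)))

  ∑ₛ-weight : ∀ {n} (w : Fin n → Bool → Carrier) → ∑ₛ (weight w) ≈ ∏ (λ i → w i false + w i true)
  ∑ₛ-weight {zero}  w = +-identityʳ 1#
  ∑ₛ-weight {suc n} w = begin
    ∑ₛ (weight w)
      ≈⟨ ∑ₛ-suc (weight w) ⟩
    ∑ₛ (λ A → w Fin.zero false * weight w′ A) + ∑ₛ (λ A → w Fin.zero true * weight w′ A)
      ≈⟨ +-cong (sumL-distribˡ _ (allSubsets n) (weight w′)) (sumL-distribˡ _ (allSubsets n) (weight w′)) ⟨
    w Fin.zero false * ∑ₛ (weight w′) + w Fin.zero true * ∑ₛ (weight w′)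
      ≈⟨ distribʳ _ _ _ ⟨
    (w Fin.zero false + w Fin.zero true) * ∑ₛ (weight w′)
      ≈⟨ *-congˡ (∑ₛ-weight w′) ⟩
    (w Fin.zero false + w Fin.zero true) * ∏ (λ i → w′ i false + w′ i true) ∎
    where
    w′ : Fin n → Bool → Carrier
    w′ i = w (Fin.suc i)

  ∑ₛ-marginalise : ∀ {n} (w : Fin n → Bool → Bool → Carrier) (f : Subset n → Carrier) →
    ∑ₛ (λ X → ∑ₛ (λ A → ∏ (λ i → w i (lookup X i) (lookup A i)) * f A))
      ≈ ∑ₛ (λ A → ∏ (λ i → w i false (lookup A i) + w i true (lookup A i)) * f A)
  ∑ₛ-marginalise {n} w f = trans (sumL-comm (allSubsets n) (allSubsets n) _) (∑ₛ-cong λ A →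
    trans (sym (sumL-distribʳ (f A) (allSubsets n) _)) (*-congʳ (∑ₛ-weight (λ i x → w i x (lookup A i)))))

  δ : ∀ {n} → Subset n → Subset n → Carrier
  δ X Y = ∏ (λ i → 𝟙 ⌊ lookup X i ≟ᵇ lookup Y i ⌋)

  ∑ₛ-δ : ∀ {n} (Y : Subset n) (f : Subset n → Carrier) → ∑ₛ (λ X → δ X Y * f X) ≈ f Y
  ∑ₛ-δ []      f = trans (+-identityʳ _) (*-identityˡ _)
  ∑ₛ-δ {suc n} (y ∷ Y) f = begin
    ∑ₛ (λ X → δ X (y ∷ Y) * f X)                     ≈⟨ ∑ₛ-suc (λ X → δ X (y ∷ Y) * f X) ⟩
    ∑ₛ (head-fixed false) + ∑ₛ (head-fixed true)    ≈⟨ +-cong (select false) (select true) ⟩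
    δ₁ false * f (false ∷ Y) + δ₁ true * f (true ∷ Y) ≈⟨ pick y ⟩
    f (y ∷ Y)                                        ∎
    where
    δ₁ : Bool → Carrier
    δ₁ b = 𝟙 ⌊ b ≟ᵇ y ⌋
    head-fixed : Bool → Subset n → Carrier
    head-fixed b X = δ (b ∷ X) (y ∷ Y) * f (b ∷ X)
    select : ∀ b → ∑ₛ (head-fixed b) ≈ δ₁ b * f (b ∷ Y)
    select b = begin
      ∑ₛ (head-fixed b)                      ≈⟨ ∑ₛ-cong {n} (λ X → *-assoc _ _ _) ⟩
      ∑ₛ (λ X → δ₁ b * (δ X Y * f (b ∷ X)))  ≈⟨ sumL-distribˡ _ (allSubsets n) _ ⟨
      δ₁ b * ∑ₛ (λ X → δ X Y * f (b ∷ X))    ≈⟨ *-congˡ (∑ₛ-δ Y (λ X → f (b ∷ X))) ⟩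
      δ₁ b * f (b ∷ Y)                       ∎
    pick : ∀ y → 𝟙 ⌊ false ≟ᵇ y ⌋ * f (false ∷ Y) + 𝟙 ⌊ true ≟ᵇ y ⌋ * f (true ∷ Y) ≈ f (y ∷ Y)
    pick false = trans (+-cong (*-identityˡ _) (zeroˡ _)) (+-identityʳ _)
    pick true  = trans (+-cong (zeroˡ _) (*-identityˡ _)) (+-identityˡ _)

  -- If in every coordinate the weight w is carried by a ↦ (α′ a, β′ a) to the product weight w₁ ⊗ w₂, then the
  -- cube weight of w is carried by A ↦ (α A, β A) to the product of the cube weights of w₁ and w₂.
  ∑ₛ-pushforward : ∀ {n} (w w₁ w₂ : Fin n → Bool → Carrier)
    (α β : Subset n → Subset n) (α′ β′ : Fin n → Bool → Bool) →
    (∀ A i → lookup (α A) i ≡ α′ i (lookup A i)) → (∀ A i → lookup (β A) i ≡ β′ i (lookup A i)) →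
    (∀ i x y → w i false * (𝟙 ⌊ x ≟ᵇ α′ i false ⌋ * 𝟙 ⌊ y ≟ᵇ β′ i false ⌋)
               + w i true * (𝟙 ⌊ x ≟ᵇ α′ i true ⌋ * 𝟙 ⌊ y ≟ᵇ β′ i true ⌋) ≈ w₁ i x * w₂ i y) →
    (Φ : Subset n → Subset n → Carrier) →
    ∑ₛ (λ A → weight w A * Φ (α A) (β A)) ≈ ∑ₛ (λ X → ∑ₛ (λ Y → (weight w₁ X * weight w₂ Y) * Φ X Y))
  ∑ₛ-pushforward {n} w w₁ w₂ α β α′ β′ α-lookup β-lookup local Φ = begin
    ∑ₛ (λ A → weight w A * Φ (α A) (β A))
      ≈⟨ ∑ₛ-cong {n} (λ A → trans (*-congˡ (unfold A)) (expand A)) ⟩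
    ∑ₛ (λ A → ∑ₛ (λ X → ∑ₛ (λ Y → coupling X Y A * Φ X Y)))
      ≈⟨ trans (sumL-comm (allSubsets n) (allSubsets n) _) (∑ₛ-cong {n} λ X → sumL-comm (allSubsets n) (allSubsets n) _) ⟩
    ∑ₛ (λ X → ∑ₛ (λ Y → ∑ₛ (λ A → coupling X Y A * Φ X Y)))
      ≈⟨ ∑ₛ-cong {n} (λ X → ∑ₛ-cong {n} λ Y →
           trans (sym (sumL-distribʳ _ (allSubsets n) _)) (*-congʳ (marginal X Y))) ⟩
    ∑ₛ (λ X → ∑ₛ (λ Y → (weight w₁ X * weight w₂ Y) * Φ X Y)) ∎
    where
    coupling : Subset n → Subset n → Subset n → Carrier
    coupling X Y A = weight w A * (δ X (α A) * δ Y (β A))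
    unfold : ∀ A → Φ (α A) (β A) ≈ ∑ₛ (λ X → δ X (α A) * ∑ₛ (λ Y → δ Y (β A) * Φ X Y))
    unfold A = sym (trans (∑ₛ-cong {n} λ X → *-congˡ (∑ₛ-δ (β A) (Φ X))) (∑ₛ-δ (α A) (λ X → Φ X (β A))))
    expand : ∀ A → weight w A * ∑ₛ (λ X → δ X (α A) * ∑ₛ (λ Y → δ Y (β A) * Φ X Y))
                   ≈ ∑ₛ (λ X → ∑ₛ (λ Y → coupling X Y A * Φ X Y))
    expand A = trans (sumL-distribˡ _ (allSubsets n) _) (∑ₛ-cong {n} λ X →
      trans (*-congˡ (sumL-distribˡ _ (allSubsets n) _)) (trans (sumL-distribˡ _ (allSubsets n) _) (∑ₛ-cong {n} λ Y →
        trans (*-congˡ (sym (*-assoc _ _ _))) (sym (*-assoc _ _ _)))))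
    marginal : ∀ X Y → ∑ₛ (coupling X Y) ≈ weight w₁ X * weight w₂ Y
    marginal X Y = begin
      ∑ₛ (coupling X Y)
        ≈⟨ ∑ₛ-cong {n} (λ A → trans (*-congˡ (sym (∏-distrib (eqα A) (eqβ A))))
                                    (sym (∏-distrib _ λ i → eqα A i * eqβ A i))) ⟩
      ∑ₛ (λ A → ∏ (λ i → w i (lookup A i) * (eqα A i * eqβ A i)))
        ≈⟨ ∑ₛ-cong {n} (λ A → ∏-cong λ i → reflexive (≡.cong₂
             (λ p q → w i (lookup A i) * (𝟙 ⌊ lookup X i ≟ᵇ p ⌋ * 𝟙 ⌊ lookup Y i ≟ᵇ q ⌋)) (α-lookup A i) (β-lookup A i))) ⟩
      ∑ₛ (weight fibre)
        ≈⟨ ∑ₛ-weight fibre ⟩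
      ∏ (λ i → fibre i false + fibre i true)
        ≈⟨ ∏-cong (λ i → local i (lookup X i) (lookup Y i)) ⟩
      ∏ (λ i → w₁ i (lookup X i) * w₂ i (lookup Y i))
        ≈⟨ ∏-distrib (λ i → w₁ i (lookup X i)) (λ i → w₂ i (lookup Y i)) ⟩
      weight w₁ X * weight w₂ Y ∎
      where
      fibre : Fin n → Bool → Carrier
      fibre i a = w i a * (𝟙 ⌊ lookup X i ≟ᵇ α′ i a ⌋ * 𝟙 ⌊ lookup Y i ≟ᵇ β′ i a ⌋)
      eqα eqβ : Subset n → Fin n → Carrier
      eqα A i = 𝟙 ⌊ lookup X i ≟ᵇ lookup (α A) i ⌋
      eqβ A i = 𝟙 ⌊ lookup Y i ≟ᵇ lookup (β A) i ⌋

-- Coordinate weights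

module CoordinateWeights {c ℓ : Level} (K : CommutativeRing c ℓ) where
  open CommutativeRing K hiding (zero)
  open import Algebra.Properties.Ring ring using (-1*x≈-x)
  open import Algebra.Properties.CommutativeSemigroup *-commutativeSemigroup using (x∙yz≈y∙xz)
  open RingOps K
  open FiniteSums K
  open CubeSums K
  open import Relation.Binary.Reasoning.Setoid setoid

  _^ᵇ_ : Carrier → Bool → Carrier
  x ^ᵇ b = if b then x else 1#

  pow-+ : ∀ x a b → pow x (a ℕ.+ b) ≈ pow x a * pow x b
  pow-+ x zero    b = sym (*-identityˡ _)
  pow-+ x (suc a) b = trans (*-congˡ (pow-+ x a b)) (sym (*-assoc _ _ _))

  pow-∣∣ : ∀ {n} (x : Carrier) (A : Subset n) → pow x ∣ A ∣ ≈ ∏ (λ i → x ^ᵇ lookup A i)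
  pow-∣∣ x []          = refl
  pow-∣∣ x (true  ∷ A) = *-congˡ (pow-∣∣ x A)
  pow-∣∣ x (false ∷ A) = trans (pow-∣∣ x A) (sym (*-identityˡ _))

  foldr-tabulate : ∀ {m n} (g : Fin n → Carrier) (h : Fin m → Fin n) →
    List.foldr (λ e acc → g e * acc) 1# (List.tabulate h) ≡ ∏ (λ i → g (h i))
  foldr-tabulate {zero}  g h = ≡.refl
  foldr-tabulate {suc m} g h = ≡.cong (g (h Fin.zero) *_) (foldr-tabulate g (λ i → h (Fin.suc i)))

  prodOver-∏ : ∀ {n} (A : Subset n) (f : Fin n → Carrier) → prodOver A f ≈ ∏ (λ i → f i ^ᵇ lookup A i)
  prodOver-∏ {n} A f = trans (reflexive (foldr-tabulate {n} (λ e → f e ^ᵇ isYes (e ∈? A)) (λ i → i)))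
    (∏-cong λ i → reflexive (≡.cong (f i ^ᵇ_) (isYes-∈? i A)))

  between : Bool → Bool → Bool → Carrier
  between x y a = 𝟙 (does (x ≤?ᵇ a)) * 𝟙 (does (a ≤?ᵇ y))

  𝟙-⊆? : ∀ {n} (X Y : Subset n) →
         𝟙 (does (X ⊆? Y)) ≈ ∏ (λ i → 𝟙 (does (lookup X i ≤?ᵇ lookup Y i)))
  𝟙-⊆? []          []          = refl
  𝟙-⊆? (false ∷ X) (y     ∷ Y) = trans (𝟙-⊆? X Y) (sym (*-identityˡ _))
  𝟙-⊆? (true  ∷ X) (false ∷ Y) = sym (zeroˡ _)
  𝟙-⊆? (true  ∷ X) (true  ∷ Y) = trans (𝟙-⊆? X Y) (sym (*-identityˡ _))

  𝟙-∧ : ∀ a b → 𝟙 (a ∧ b) ≈ 𝟙 a * 𝟙 b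
  𝟙-∧ false b = sym (zeroˡ _)
  𝟙-∧ true  b = sym (*-identityˡ _)

  ∏-between : ∀ {n} (X Y A : Subset n) →
    ∏ (λ i → between (lookup X i) (lookup Y i) (lookup A i)) ≈ 𝟙 (does (X ⊆? A) ∧ does (A ⊆? Y))
  ∏-between X Y A = begin
    ∏ (λ i → between (lookup X i) (lookup Y i) (lookup A i))
      ≈⟨ ∏-distrib below above ⟩
    ∏ below * ∏ above
      ≈⟨ *-cong (𝟙-⊆? X A) (𝟙-⊆? A Y) ⟨
    𝟙 (does (X ⊆? A)) * 𝟙 (does (A ⊆? Y))
      ≈⟨ 𝟙-∧ _ _ ⟨
    𝟙 (does (X ⊆? A) ∧ does (A ⊆? Y)) ∎
    where
    below above : Fin _ → Carrier
    below i = 𝟙 (does (lookup X i ≤?ᵇ lookup A i))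
    above i = 𝟙 (does (lookup A i ≤?ᵇ lookup Y i))

  sumL-interval : ∀ {n} (X Y : Subset n) {f g : Subset n → Carrier} →
    (∀ A → X ⊆ A → A ⊆ Y → f A ≈ g A) →
    sumL (interval X Y) f ≈ ∑ₛ (λ A → ∏ (λ i → between (lookup X i) (lookup Y i) (lookup A i)) * g A)
  sumL-interval {n} X Y {f} {g} f≈g = trans (sumL-filter (λ A → (X ⊆? A) ×-dec (A ⊆? Y)) (allSubsets n) f)
    (∑ₛ-cong {n} λ A → trans (restrict A) (*-congʳ (sym (∏-between X Y A))))
    where
    restrict : ∀ A → 𝟙 (does (X ⊆? A) ∧ does (A ⊆? Y)) * f A
                     ≈ 𝟙 (does (X ⊆? A) ∧ does (A ⊆? Y)) * g A
    restrict A with X ⊆? A | A ⊆? Y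
    ... | yes X⊆A | yes A⊆Y = *-congˡ (f≈g A X⊆A A⊆Y)
    ... | yes _   | no _    = trans (zeroˡ _) (sym (zeroˡ _))
    ... | no _    | _       = trans (zeroˡ _) (sym (zeroˡ _))

  sumL-interval-cong : ∀ {n} (X Y : Subset n) {f g : Subset n → Carrier} →
    (∀ A → X ⊆ A → A ⊆ Y → f A ≈ g A) →
    sumL (interval X Y) f ≈ sumL (interval X Y) g
  sumL-interval-cong X Y f≈g = trans (sumL-interval X Y f≈g) (sym (sumL-interval X Y (λ _ _ _ → refl)))

  sign-∣─∣ : ∀ {n} {Y A : Subset n} → A ⊆ Y →
             sign (∣ Y ∣ ∸ ∣ A ∣) ≈ ∏ (λ i → (- 1#) ^ᵇ (lookup Y i ∧ not (lookup A i)))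
  sign-∣─∣ {Y = Y} {A} A⊆Y = begin
    sign (∣ Y ∣ ∸ ∣ A ∣)
      ≡⟨ ≡.cong sign (∣─∣ A⊆Y) ⟩
    sign ∣ Y ─ A ∣
      ≈⟨ pow-∣∣ (- 1#) (Y ─ A) ⟩
    ∏ (λ i → (- 1#) ^ᵇ lookup (Y ─ A) i)
      ≈⟨ ∏-cong (λ i → reflexive (≡.cong ((- 1#) ^ᵇ_) (lookup-─ Y A i))) ⟩
    ∏ (λ i → (- 1#) ^ᵇ (lookup Y i ∧ not (lookup A i))) ∎

  alternating : Bool → Bool → Bool → Carrier
  alternating x y a = between x y a * (- 1#) ^ᵇ (y ∧ not a)

  alternating-∑ₛ : ∀ {n} (X Y : Subset n) {g h : Subset n → Carrier} →
    (∀ A → X ⊆ A → A ⊆ Y → g A ≈ h A) →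
    sumL (interval X Y) (λ A → sign (∣ Y ∣ ∸ ∣ A ∣) * g A)
      ≈ ∑ₛ (λ A → ∏ (λ i → alternating (lookup X i) (lookup Y i) (lookup A i)) * h A)
  alternating-∑ₛ {n} X Y g≈h =
    trans (sumL-interval X Y (λ A X⊆A A⊆Y → *-cong (sign-∣─∣ A⊆Y) (g≈h A X⊆A A⊆Y))) (∑ₛ-cong {n} λ A →
      trans (sym (*-assoc _ _ _)) (*-congʳ (sym (∏-distrib (λ i → between (lookup X i) (lookup Y i) (lookup A i))
                                                          (λ i → (- 1#) ^ᵇ (lookup Y i ∧ not (lookup A i)))))))

  ρ-weight : Bool → Bool → Bool → Bool → Carrier
  ρ-weight r s f a = alternating r s a * (- 1#) ^ᵇ ((s ∧ not r) ∧ not f)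

  ρ-scale : ∀ {n} (rk : Subset n → ℕ) (g : Subset n → Carrier) x R′ S′ →
            x * ρ rk g R′ S′ ≈ ρ rk (λ A → x * g A) R′ S′
  ρ-scale rk g x R′ S′ = trans (x∙yz≈y∙xz x _ _) (*-congˡ (trans (sumL-distribˡ x (interval R′ S′) _)
    (sumL-cong (interval R′ S′) λ A → x∙yz≈y∙xz x _ (g A))))

  -- The factors 𝟙 b * y, x ^ᵇ b * y and (- 1#) ^ᵇ b * y as functions computing by cases on b, so that
  -- coordinate weights at literal Booleans reduce to short ring expressions.
  guard : Bool → Carrier → Carrier
  guard true  y = y
  guard false y = 0#

  scaleBy : Bool → Carrier → Carrier → Carrier
  scaleBy true  x y = x * y
  scaleBy false x y = y

  negateBy : Bool → Carrier → Carrier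
  negateBy true  y = - y
  negateBy false y = y

  guard-cong : ∀ b {y z} → y ≈ z → guard b y ≈ guard b z
  guard-cong true  y≈z = y≈z
  guard-cong false y≈z = refl

  scaleBy-cong : ∀ b x {y z} → y ≈ z → scaleBy b x y ≈ scaleBy b x z
  scaleBy-cong true  x y≈z = *-congˡ y≈z
  scaleBy-cong false x y≈z = y≈z

  negateBy-cong : ∀ b {y z} → y ≈ z → negateBy b y ≈ negateBy b z
  negateBy-cong true  y≈z = -‿cong y≈z
  negateBy-cong false y≈z = y≈z

  scaleBy-unit : ∀ b {x} y → x ≈ 1# → scaleBy b x y ≈ y
  scaleBy-unit true  y x≈1 = trans (*-congʳ x≈1) (*-identityˡ y)
  scaleBy-unit false y x≈1 = refl

  𝟙-* : ∀ b z → 𝟙 b * z ≈ guard b z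
  𝟙-* true  z = *-identityˡ z
  𝟙-* false z = zeroˡ z

  ^ᵇ-* : ∀ x b z → x ^ᵇ b * z ≈ scaleBy b x z
  ^ᵇ-* x true  z = refl
  ^ᵇ-* x false z = *-identityˡ z

  sign-* : ∀ b z → (- 1#) ^ᵇ b * z ≈ negateBy b z
  sign-* true  z = -1*x≈-x z
  sign-* false z = *-identityˡ z

  between-* : ∀ x y a z → between x y a * z ≈ guard (does (x ≤?ᵇ a)) (guard (does (a ≤?ᵇ y)) z)
  between-* x y a z =
    trans (*-assoc _ _ _) (trans (𝟙-* (does (x ≤?ᵇ a)) _) (guard-cong (does (x ≤?ᵇ a)) (𝟙-* (does (a ≤?ᵇ y)) z)))

  ρ-weight-* : ∀ r s f a z → ρ-weight r s f a * z
    ≈ guard (does (r ≤?ᵇ a)) (guard (does (a ≤?ᵇ s)) (negateBy (s ∧ not a) (negateBy ((s ∧ not r) ∧ not f) z)))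
  ρ-weight-* r s f a z = begin
    ((between r s a * (- 1#) ^ᵇ (s ∧ not a)) * (- 1#) ^ᵇ ((s ∧ not r) ∧ not f)) * z
      ≈⟨ trans (*-assoc _ _ _) (*-assoc _ _ _) ⟩
    between r s a * ((- 1#) ^ᵇ (s ∧ not a) * ((- 1#) ^ᵇ ((s ∧ not r) ∧ not f) * z))
      ≈⟨ between-* r s a _ ⟩
    guard (does (r ≤?ᵇ a)) (guard (does (a ≤?ᵇ s)) ((- 1#) ^ᵇ (s ∧ not a) * ((- 1#) ^ᵇ ((s ∧ not r) ∧ not f) * z)))
      ≈⟨ guard-cong (does (r ≤?ᵇ a)) (guard-cong (does (a ≤?ᵇ s))
           (trans (sign-* (s ∧ not a) _) (negateBy-cong (s ∧ not a) (sign-* ((s ∧ not r) ∧ not f) z)))) ⟩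
    guard (does (r ≤?ᵇ a)) (guard (does (a ≤?ᵇ s)) (negateBy (s ∧ not a) (negateBy ((s ∧ not r) ∧ not f) z))) ∎

-- Molecules

data Role : (r f t s : Bool) → Set where
  ∈R : Role true  false false true
  ∈F : Role false true  false true
  ∈T : Role false false true  true
  ∉S : Role false false false false

role : ∀ r f t → r ∧ f ≡ false → r ∧ t ≡ false → f ∧ t ≡ false → Role r f t ((r ∨ f) ∨ t)
role true  true  _     () _  _
role true  false true  _  () _
role true  false false _  _  _ = ∈R
role false true  true  _  _  ()
role false true  false _  _  _ = ∈F
role false false true  _  _  _ = ∈T
role false false false _  _  _ = ∉S

∪⊆─-coordinate : ∀ {r f t s k l} → Role r f t s → k ≤ f → l ≤ t → r ∨ l ≤ s ∧ not k
∪⊆─-coordinate ∈R b≤b b≤b = b≤b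
∪⊆─-coordinate ∈F _   b≤b = ≤-minimum _
∪⊆─-coordinate ∈T b≤b _   = ≤-maximum _
∪⊆─-coordinate ∉S b≤b b≤b = b≤b

restrict-coordinate : ∀ {r f t s a} → Role r f t s → r ≤ a → a ≤ s →
  (r ∧ (a ∧ f) ≡ false) × (r ∧ (a ∧ t) ≡ false) × ((a ∧ f) ∧ (a ∧ t) ≡ false)
  × (a ≡ (r ∨ (a ∧ f)) ∨ (a ∧ t))
restrict-coordinate ∈R b≤b _   = ≡.refl , ≡.refl , ≡.refl , ≡.refl
restrict-coordinate ∈F b≤b _   = ≡.refl , ≡.refl , ≡.refl , ≡.refl
restrict-coordinate ∈F f≤t _   = ≡.refl , ≡.refl , ≡.refl , ≡.refl
restrict-coordinate ∈T b≤b _   = ≡.refl , ≡.refl , ≡.refl , ≡.refl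
restrict-coordinate ∈T f≤t _   = ≡.refl , ≡.refl , ≡.refl , ≡.refl
restrict-coordinate ∉S b≤b b≤b = ≡.refl , ≡.refl , ≡.refl , ≡.refl

module Molecule {n} (rk : Subset n → ℕ) {R S F T : Subset n} (mol : IsMolecule rk R S F T) where
  open import Data.Nat.Base using (_+_)
  open ≡-Reasoning

  private
    R∩F≡∅ : R ∩ F ≡ ∅
    R∩F≡∅ = proj₁ mol
    R∩T≡∅ : R ∩ T ≡ ∅
    R∩T≡∅ = proj₁ (proj₂ mol)
    F∩T≡∅ : F ∩ T ≡ ∅
    F∩T≡∅ = proj₁ (proj₂ (proj₂ mol))
    S≡R∪F∪T : S ≡ (R ∪ F) ∪ T
    S≡R∪F∪T = proj₁ (proj₂ (proj₂ (proj₂ mol)))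

  rk-formula : ∀ {A} → R ⊆ A → A ⊆ S → rk A ≡ rk R + ∣ A ∩ F ∣
  rk-formula = proj₂ (proj₂ (proj₂ (proj₂ mol))) _

  R⊆S : R ⊆ S
  R⊆S = subst (R ⊆_) (≡.sym S≡R∪F∪T) (⊆-trans (p⊆p∪q F) (p⊆p∪q T))

  F⊆S : F ⊆ S
  F⊆S = subst (F ⊆_) (≡.sym S≡R∪F∪T) (⊆-trans (q⊆p∪q R F) (p⊆p∪q T))

  T⊆S : T ⊆ S
  T⊆S = subst (T ⊆_) (≡.sym S≡R∪F∪T) (q⊆p∪q (R ∪ F) T)

  lookup-S : ∀ i → lookup S i ≡ (lookup R i ∨ lookup F i) ∨ lookup T i
  lookup-S i = begin
    lookup S i                              ≡⟨ ≡.cong (λ X → lookup X i) S≡R∪F∪T ⟩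
    lookup ((R ∪ F) ∪ T) i                  ≡⟨ lookup-zipWith _∨_ i (R ∪ F) T ⟩
    lookup (R ∪ F) i ∨ lookup T i           ≡⟨ ≡.cong (_∨ lookup T i) (lookup-zipWith _∨_ i R F) ⟩
    (lookup R i ∨ lookup F i) ∨ lookup T i  ∎

  role-at : ∀ i → Role (lookup R i) (lookup F i) (lookup T i) (lookup S i)
  role-at i = subst (Role _ _ _) (≡.sym (lookup-S i))
    (role _ _ _ (disjoint R∩F≡∅) (disjoint R∩T≡∅) (disjoint F∩T≡∅))
    where
    disjoint : ∀ {X Y : Subset n} → X ∩ Y ≡ ∅ → lookup X i ∧ lookup Y i ≡ false
    disjoint {X} {Y} X∩Y≡∅ =
      ≡.trans (≡.sym (lookup-zipWith _∧_ i X Y)) (≡.trans (≡.cong (λ Z → lookup Z i) X∩Y≡∅) (lookup-replicate i false))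

  rank-step : ∀ {X} i → R ⊆ X → X ∪ ⁅ i ⁆ ⊆ S → lookup X i ≡ false →
              rk (X ∪ ⁅ i ⁆) ≡ (if lookup F i then suc (rk X) else rk X)
  rank-step {X} i R⊆X X+i⊆S i∉X = begin
    rk (X ∪ ⁅ i ⁆)                                ≡⟨ rk-formula (⊆-trans R⊆X (p⊆p∪q ⁅ i ⁆)) X+i⊆S ⟩
    rk R + ∣ (X ∪ ⁅ i ⁆) ∩ F ∣                     ≡⟨ ≡.cong (rk R ℕ.+_) (∣∪⁅⁆∩∣ X F i i∉X) ⟩
    rk R + (if lookup F i then suc c else c)       ≡⟨ shift (lookup F i) ⟩
    (if lookup F i then suc (rk R + c) else rk R + c) ≡⟨ ≡.cong (λ x → if lookup F i then suc x else x) rk-X ⟨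
    (if lookup F i then suc (rk X) else rk X)       ∎
    where
    c : ℕ
    c = ∣ X ∩ F ∣
    rk-X : rk X ≡ rk R + c
    rk-X = rk-formula R⊆X (⊆-trans (p⊆p∪q ⁅ i ⁆) X+i⊆S)
    shift : ∀ b → rk R + (if b then suc c else c) ≡ (if b then suc (rk R + c) else rk R + c)
    shift true  = ℕP.+-suc (rk R) c
    shift false = ≡.refl

  R∪L⊆S─K : ∀ {K L} → K ⊆ F → L ⊆ T → R ∪ L ⊆ S ─ K
  R∪L⊆S─K {K} {L} K⊆F L⊆T = lookup-≤⇒⊆ λ i →
    subst₂ _≤_ (≡.sym (lookup-zipWith _∨_ i R L)) (≡.sym (lookup-─ S K i))
      (∪⊆─-coordinate (role-at i) (⊆⇒lookup-≤ K⊆F i) (⊆⇒lookup-≤ L⊆T i))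

  tPart-sub : ∀ {R′ S′} → R ⊆ R′ → R′ ⊆ S′ → S′ ⊆ S → tPart rk R′ S′ ≡ (S′ ─ R′) ─ F
  tPart-sub {R′} {S′} R⊆R′ R′⊆S′ S′⊆S = ≡-lookup λ i → begin
    lookup (tPart rk R′ S′) i
      ≡⟨ lookup∘tabulate _ i ⟩
    ⌊ i ∈? S′ ⌋ ∧ not ⌊ i ∈? R′ ⌋ ∧ not (jumps i)
      ≡⟨ ≡.cong₂ (λ s r → s ∧ not r ∧ not (jumps i)) (isYes-∈? i S′) (isYes-∈? i R′) ⟩
    lookup S′ i ∧ not (lookup R′ i) ∧ not (jumps i)
      ≡⟨ coordinate i ⟩
    (lookup S′ i ∧ not (lookup R′ i)) ∧ not (lookup F i)
      ≡⟨ ≡.trans (lookup-─ (S′ ─ R′) F i) (≡.cong (_∧ not (lookup F i)) (lookup-─ S′ R′ i)) ⟨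
    lookup ((S′ ─ R′) ─ F) i ∎
    where
    jumps : Fin n → Bool
    jumps i = ⌊ rk (R′ ∪ ⁅ i ⁆) ℕ.≟ suc (rk R′) ⌋
    jumps-by : ∀ i b → rk (R′ ∪ ⁅ i ⁆) ≡ (if b then suc (rk R′) else rk R′) → jumps i ≡ b
    jumps-by i true  eq = ≡.trans (isYes≗does _) (dec-true (rk (R′ ∪ ⁅ i ⁆) ℕ.≟ suc (rk R′)) eq)
    jumps-by i false eq = ≡.trans (isYes≗does _)
      (dec-false (rk (R′ ∪ ⁅ i ⁆) ℕ.≟ suc (rk R′)) λ eq′ → ℕP.1+n≢n (≡.trans (≡.sym eq′) eq))
    coordinate : ∀ i → lookup S′ i ∧ not (lookup R′ i) ∧ not (jumps i) ≡ (lookup S′ i ∧ not (lookup R′ i)) ∧ not (lookup F i)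
    coordinate i with lookup S′ i in i∈S′ | lookup R′ i in i∉R′
    ... | false | _     = ≡.refl
    ... | true  | true  = ≡.refl
    ... | true  | false = ≡.cong not (jumps-by i (lookup F i) (rank-step i R⊆R′ R′+i⊆S i∉R′))
      where
      R′+i⊆S : R′ ∪ ⁅ i ⁆ ⊆ S
      R′+i⊆S {x} x∈R′+i with x∈p∪q⁻ R′ ⁅ i ⁆ x∈R′+i
      ... | inj₁ x∈R′ = S′⊆S (R′⊆S′ x∈R′)
      ... | inj₂ x∈i  = subst (_∈ S) (≡.sym (x∈⁅y⁆⇒x≡y i x∈i)) (S′⊆S (lookup⇒[]= i S′ i∈S′))

  restriction : ∀ {A} → R ⊆ A → A ⊆ S → IsMolecule rk R A (A ∩ F) (A ∩ T)
  restriction {A} R⊆A A⊆S = R∩A∩F≡∅ , R∩A∩T≡∅ , A∩F∩A∩T≡∅ , A-split , rank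
    where
    r f t a : Fin n → Bool
    r i = lookup R i
    f i = lookup F i
    t i = lookup T i
    a i = lookup A i
    coordinate : ∀ i → (r i ∧ (a i ∧ f i) ≡ false) × (r i ∧ (a i ∧ t i) ≡ false)
                       × ((a i ∧ f i) ∧ (a i ∧ t i) ≡ false)
                       × (a i ≡ (r i ∨ (a i ∧ f i)) ∨ (a i ∧ t i))
    coordinate i = restrict-coordinate (role-at i) (⊆⇒lookup-≤ R⊆A i) (⊆⇒lookup-≤ A⊆S i)
    lookup-∩ : ∀ (X Y : Subset n) i → lookup (X ∩ Y) i ≡ lookup X i ∧ lookup Y i
    lookup-∩ X Y i = lookup-zipWith _∧_ i X Y
    ≡∅ : ∀ {X : Subset n} → (∀ i → lookup X i ≡ false) → X ≡ ∅
    ≡∅ X≡false = ≡-lookup λ i → ≡.trans (X≡false i) (≡.sym (lookup-replicate i false))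
    R∩A∩F≡∅ : R ∩ (A ∩ F) ≡ ∅
    R∩A∩F≡∅ = ≡∅ λ i → ≡.trans (lookup-∩ R (A ∩ F) i)
      (≡.trans (≡.cong (r i ∧_) (lookup-∩ A F i)) (proj₁ (coordinate i)))
    R∩A∩T≡∅ : R ∩ (A ∩ T) ≡ ∅
    R∩A∩T≡∅ = ≡∅ λ i → ≡.trans (lookup-∩ R (A ∩ T) i)
      (≡.trans (≡.cong (r i ∧_) (lookup-∩ A T i)) (proj₁ (proj₂ (coordinate i))))
    A∩F∩A∩T≡∅ : (A ∩ F) ∩ (A ∩ T) ≡ ∅
    A∩F∩A∩T≡∅ = ≡∅ λ i → ≡.trans (lookup-∩ (A ∩ F) (A ∩ T) i)
      (≡.trans (≡.cong₂ _∧_ (lookup-∩ A F i) (lookup-∩ A T i)) (proj₁ (proj₂ (proj₂ (coordinate i)))))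
    A-split : A ≡ (R ∪ (A ∩ F)) ∪ (A ∩ T)
    A-split = ≡-lookup λ i → ≡.trans (proj₂ (proj₂ (proj₂ (coordinate i)))) (≡.sym (begin
      lookup ((R ∪ (A ∩ F)) ∪ (A ∩ T)) i
        ≡⟨ lookup-zipWith _∨_ i (R ∪ (A ∩ F)) (A ∩ T) ⟩
      lookup (R ∪ (A ∩ F)) i ∨ lookup (A ∩ T) i
        ≡⟨ ≡.cong₂ _∨_ (≡.trans (lookup-zipWith _∨_ i R (A ∩ F)) (≡.cong (r i ∨_) (lookup-∩ A F i))) (lookup-∩ A T i) ⟩
      (r i ∨ (a i ∧ f i)) ∨ (a i ∧ t i) ∎))
    rank : ∀ B → R ⊆ B → B ⊆ A → rk B ≡ rk R + ∣ B ∩ (A ∩ F) ∣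
    rank B R⊆B B⊆A = ≡.trans (rk-formula R⊆B (⊆-trans B⊆A A⊆S))
      (≡.cong (λ X → rk R + ∣ X ∣) (≡.trans (≡.cong (_∩ F) (≡.sym (⊆⇒∩≡ B⊆A))) (∩-assoc B A F)))

  module _ (m : Subset n → ℕ) (A1h : A1 rk m) where

    -- Removing an element x of X ∖ R preserves the hypotheses; x lies in F, so putting it back raises the
    -- rank and (A1) applies.
    m-divides : ∀ X → R ⊆ X → X ⊆ R ∪ F → m R ∣ℕ m X
    m-divides = All.wfRec ⊂-wellFounded 0ℓ P step
      where
      P : Subset n → Set
      P Y = R ⊆ Y → Y ⊆ R ∪ F → m R ∣ℕ m Y
      step : ∀ X → WfRec _⊂_ P X → P X
      step X ih R⊆X X⊆R∪F with nonempty? (X ─ R)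
      ... | no X─R-empty = subst (λ Y → m R ∣ℕ m Y) (⊆-antisym R⊆X X⊆R) ∣-refl
        where
        X⊆R : X ⊆ R
        X⊆R {y} y∈X with y ∈? R
        ... | yes y∈R = y∈R
        ... | no  y∉R = ⊥-elim (X─R-empty (y , x∈p∧x∉q⇒x∈p─q y∈X y∉R))
      ... | yes (x , x∈X─R) =
        ∣-trans (ih (x∈p⇒p-x⊂p x∈X) R⊆X-x (⊆-trans (p─q⊆p X ⁅ x ⁆) X⊆R∪F))
                (subst (λ Y → m (X - x) ∣ℕ m Y) (p-x∪⁅x⁆≡p x∈X) (proj₂ (A1h (X - x) x) rank-grows))
        where
        x∈X : x ∈ X
        x∈X = p─q⊆p X R x∈X─R
        x∉R : x ∉ R
        x∉R = x∈p─q⇒x∉q X R x∈X─R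
        R⊆X-x : R ⊆ X - x
        R⊆X-x y∈R = x∈p∧x≢y⇒x∈p-y (R⊆X y∈R) (λ y≡x → x∉R (subst (_∈ R) y≡x y∈R))
        x∈F : lookup F x ≡ true
        x∈F with x∈p∪q⁻ R F (X⊆R∪F x∈X)
        ... | inj₁ x∈R = ⊥-elim (x∉R x∈R)
        ... | inj₂ x∈F = []=⇒lookup x∈F
        X-x+x⊆S : (X - x) ∪ ⁅ x ⁆ ⊆ S
        X-x+x⊆S = subst (_⊆ S) (≡.sym (p-x∪⁅x⁆≡p x∈X)) (⊆-trans X⊆R∪F (∪-least R⊆S F⊆S))
        rank-grows : ¬ (rk ((X - x) ∪ ⁅ x ⁆) ≡ rk (X - x))
        rank-grows eq = ℕP.1+n≢n (≡.trans (≡.sym rank-step-x) eq)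
          where
          rank-step-x : rk ((X - x) ∪ ⁅ x ⁆) ≡ suc (rk (X - x))
          rank-step-x = subst (λ b → rk ((X - x) ∪ ⁅ x ⁆) ≡ (if b then suc (rk (X - x)) else rk (X - x))) x∈F
                              (rank-step x R⊆X-x X-x+x⊆S (lookup-─-∈ X (x∈⁅x⁆ x)))

module MoleculeSums {c ℓ : Level} (K : CommutativeRing c ℓ) {n} (rk : Subset n → ℕ) {R S F T : Subset n}
                    (mol : IsMolecule rk R S F T) where
  open CommutativeRing K hiding (zero)
  open RingOps K
  open FiniteSums K
  open CubeSums K
  open CoordinateWeights K
  open Molecule rk mol
  open import Relation.Binary.Reasoning.Setoid setoid

  ρ-cube : ∀ {R′ S′} → R ⊆ R′ → R′ ⊆ S′ → S′ ⊆ S →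
    {g h : Subset n → Carrier} → (∀ A → R′ ⊆ A → A ⊆ S′ → g A ≈ h A) →
    ρ rk g R′ S′ ≈ ∑ₛ (λ A → ∏ (λ i → ρ-weight (lookup R′ i) (lookup S′ i) (lookup F i) (lookup A i)) * h A)
  ρ-cube {R′} {S′} R⊆R′ R′⊆S′ S′⊆S {g} {h} g≈h = begin
    sign ∣ tPart rk R′ S′ ∣ * sumL (interval R′ S′) (λ A → sign (∣ S′ ∣ ℕ.∸ ∣ A ∣) * g A)
      ≈⟨ *-cong sign-tPart (alternating-∑ₛ R′ S′ g≈h) ⟩
    ∏ σ * ∑ₛ (λ A → ∏ (alt A) * h A)
      ≈⟨ sumL-distribˡ (∏ σ) (allSubsets n) _ ⟩
    ∑ₛ (λ A → ∏ σ * (∏ (alt A) * h A))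
      ≈⟨ ∑ₛ-cong {n} (λ A → trans (sym (*-assoc _ _ _))
           (*-congʳ (trans (*-comm _ _) (sym (∏-distrib (alt A) σ))))) ⟩
    ∑ₛ (λ A → ∏ (λ i → ρ-weight (lookup R′ i) (lookup S′ i) (lookup F i) (lookup A i)) * h A) ∎
    where
    σ : Fin n → Carrier
    σ i = (- 1#) ^ᵇ ((lookup S′ i ∧ not (lookup R′ i)) ∧ not (lookup F i))
    alt : Subset n → Fin n → Carrier
    alt A i = alternating (lookup R′ i) (lookup S′ i) (lookup A i)
    sign-tPart : sign ∣ tPart rk R′ S′ ∣ ≈ ∏ σ
    sign-tPart = trans (reflexive (≡.cong (λ X → sign ∣ X ∣) (tPart-sub R⊆R′ R′⊆S′ S′⊆S)))
      (trans (pow-∣∣ (- 1#) ((S′ ─ R′) ─ F)) (∏-cong λ i → reflexive (≡.cong ((- 1#) ^ᵇ_)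
        (≡.trans (lookup-─ (S′ ─ R′) F i) (≡.cong (_∧ not (lookup F i)) (lookup-─ S′ R′ i))))))

-- The first identity

module FirstIdentityCoordinates {c ℓ : Level} (K : CommutativeRing c ℓ) where
  open CommutativeRing K hiding (zero)
  open CoordinateWeights K

  lhs-weight : (r f s : Bool) (qi vᵢ : Carrier) → Bool → Carrier
  lhs-weight r f s qi vᵢ a = guard (does (r ≤?ᵇ a)) (guard (does (a ≤?ᵇ s)) (scaleBy (a ∧ f) qi (vᵢ ^ᵇ a)))

  -- The coordinate weight of the (K, L, A) summand on the right, including the coordinate's share of
  -- q^{-rk S} ∏_{R ∪ F} v. The indicators come first so that vanishing terms reduce to 0#.
  rhs-weight : (r f t s : Bool) (q qi vᵢ viᵢ : Carrier) → Bool → Bool → Bool → Carrier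
  rhs-weight r f t s q qi vᵢ viᵢ k l a =
    guard (does (k ≤?ᵇ f)) (guard (does (l ≤?ᵇ t)) (guard (does ((r ∨ l) ≤?ᵇ a)) (guard (does (a ≤?ᵇ (s ∧ not k)))
      (negateBy ((s ∧ not k) ∧ not a) (negateBy (((s ∧ not k) ∧ not (r ∨ l)) ∧ not f)
        (scaleBy (s ∧ f) qi (scaleBy (r ∨ f) vᵢ (scaleBy k (q * viᵢ + 1#) ((vᵢ + 1#) ^ᵇ l)))))))))

  lhs-weight-product : ∀ r f s qi vᵢ a → between r s a * (qi ^ᵇ (a ∧ f) * vᵢ ^ᵇ a) ≈ lhs-weight r f s qi vᵢ a
  lhs-weight-product r f s qi vᵢ a = trans (between-* r s a _)
    (guard-cong (does (r ≤?ᵇ a)) (guard-cong (does (a ≤?ᵇ s)) (^ᵇ-* qi (a ∧ f) _)))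

  rhs-weight-product : ∀ r f t s q qi vᵢ viᵢ k l a →
    between false f k * (between false t l * (ρ-weight (r ∨ l) (s ∧ not k) f a *
      (qi ^ᵇ (s ∧ f) * (vᵢ ^ᵇ (r ∨ f) * ((q * viᵢ + 1#) ^ᵇ k * (vᵢ + 1#) ^ᵇ l)))))
      ≈ rhs-weight r f t s q qi vᵢ viᵢ k l a
  rhs-weight-product r f t s q qi vᵢ viᵢ k l a =
    trans (between-* false f k _) (guard-cong (does (k ≤?ᵇ f)) (
    trans (between-* false t l _) (guard-cong (does (l ≤?ᵇ t)) (
    trans (ρ-weight-* (r ∨ l) (s ∧ not k) f a _) (guard-cong (does ((r ∨ l) ≤?ᵇ a)) (guard-cong (does (a ≤?ᵇ (s ∧ not k)))
      (negateBy-cong ((s ∧ not k) ∧ not a) (negateBy-cong (((s ∧ not k) ∧ not (r ∨ l)) ∧ not f) (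
    trans (^ᵇ-* qi (s ∧ f) _) (scaleBy-cong (s ∧ f) qi (
    trans (^ᵇ-* vᵢ (r ∨ f) _) (scaleBy-cong (r ∨ f) vᵢ (^ᵇ-* (q * viᵢ + 1#) k _)))))))))))))

  private
    open import Relation.Binary.Reasoning.Setoid setoid
    open import Algebra.Properties.Ring ring using (-‿involutive)
    open import Algebra.Solver.CommutativeMonoid *-commutativeMonoid using (solve; _⊜_; _⊕_; id)

    drop-zeros : ∀ x → x + (0# + 0#) ≈ x
    drop-zeros x = trans (+-congˡ (+-identityʳ 0#)) (+-identityʳ x)

    only-first : ∀ x → (x + 0#) + (0# + 0#) ≈ x
    only-first x = trans (drop-zeros (x + 0#)) (+-identityʳ x)

    all-zero : (0# + 0#) + (0# + 0#) ≈ 0#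
    all-zero = only-first 0#

    F-absent : ∀ q qi vᵢ viᵢ → (- (qi * (vᵢ * 1#)) + 0#) + (qi * (vᵢ * ((q * viᵢ + 1#) * 1#)) + 0#)
                             ≈ ((q * qi) * (vᵢ * viᵢ)) * 1#
    F-absent q qi vᵢ viᵢ = begin
      (- (qi * (vᵢ * 1#)) + 0#) + (qi * (vᵢ * ((q * viᵢ + 1#) * 1#)) + 0#)
        ≈⟨ +-cong (+-identityʳ _) (+-identityʳ _) ⟩
      - (qi * (vᵢ * 1#)) + qi * (vᵢ * ((q * viᵢ + 1#) * 1#))
        ≈⟨ +-congˡ (*-congˡ (*-congˡ (trans (*-identityʳ _) (+-comm _ _)))) ⟩
      - (qi * (vᵢ * 1#)) + qi * (vᵢ * (1# + q * viᵢ))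
        ≈⟨ +-congˡ (trans (*-congˡ (distribˡ vᵢ 1# _)) (distribˡ qi _ _)) ⟩
      - (qi * (vᵢ * 1#)) + (qi * (vᵢ * 1#) + qi * (vᵢ * (q * viᵢ)))
        ≈⟨ +-assoc _ _ _ ⟨
      (- (qi * (vᵢ * 1#)) + qi * (vᵢ * 1#)) + qi * (vᵢ * (q * viᵢ))
        ≈⟨ trans (+-congʳ (-‿inverseˡ _)) (+-identityˡ _) ⟩
      qi * (vᵢ * (q * viᵢ))
        ≈⟨ solve 4 (λ q qi vᵢ viᵢ → qi ⊕ (vᵢ ⊕ (q ⊕ viᵢ)) ⊜ ((q ⊕ qi) ⊕ (vᵢ ⊕ viᵢ)) ⊕ id) refl q qi vᵢ viᵢ ⟩
      ((q * qi) * (vᵢ * viᵢ)) * 1# ∎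

    T-absent : (- (- 1#) + 0#) + (0# + 0#) ≈ 1#
    T-absent = trans (only-first (- (- 1#))) (-‿involutive 1#)

    T-present : ∀ vᵢ → (- 1# + (vᵢ + 1#)) + (0# + 0#) ≈ vᵢ
    T-present vᵢ = begin
      (- 1# + (vᵢ + 1#)) + (0# + 0#)       ≈⟨ drop-zeros _ ⟩
      - 1# + (vᵢ + 1#)                     ≈⟨ +-comm _ _ ⟩
      (vᵢ + 1#) + - 1#                     ≈⟨ +-assoc _ _ _ ⟩
      vᵢ + (1# + - 1#)                     ≈⟨ +-congˡ (-‿inverseʳ 1#) ⟩
      vᵢ + 0#                              ≈⟨ +-identityʳ vᵢ ⟩
      vᵢ                                   ∎

  coordinate-identity₁ : ∀ {r f t s} → Role r f t s → ∀ (q qi vᵢ viᵢ : Carrier) a →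
    (rhs-weight r f t s q qi vᵢ viᵢ false false a + rhs-weight r f t s q qi vᵢ viᵢ false true a)
      + (rhs-weight r f t s q qi vᵢ viᵢ true false a + rhs-weight r f t s q qi vᵢ viᵢ true true a)
      ≈ scaleBy (f ∧ not a) ((q * qi) * (vᵢ * viᵢ)) (lhs-weight r f s qi vᵢ a)
  coordinate-identity₁ ∈R q qi vᵢ viᵢ false = all-zero
  coordinate-identity₁ ∈R q qi vᵢ viᵢ true  = trans (only-first (vᵢ * 1#)) (*-identityʳ vᵢ)
  coordinate-identity₁ ∈F q qi vᵢ viᵢ false = F-absent q qi vᵢ viᵢ
  coordinate-identity₁ ∈F q qi vᵢ viᵢ true  = trans (only-first (qi * (vᵢ * 1#))) (*-congˡ (*-identityʳ vᵢ))
  coordinate-identity₁ ∈T q qi vᵢ viᵢ false = T-absent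
  coordinate-identity₁ ∈T q qi vᵢ viᵢ true  = T-present vᵢ
  coordinate-identity₁ ∉S q qi vᵢ viᵢ false = only-first 1#
  coordinate-identity₁ ∉S q qi vᵢ viᵢ true  = all-zero

module FirstIdentity {c ℓ : Level} (K : CommutativeRing c ℓ) {n} (rk : Subset n → ℕ) {R S F T : Subset n}
                     (mol : IsMolecule rk R S F T) where
  open CommutativeRing K hiding (zero)
  open RingOps K
  open FiniteSums K
  open CubeSums K
  open CoordinateWeights K
  open FirstIdentityCoordinates K
  open Molecule rk mol
  open MoleculeSums K rk mol
  open import Relation.Binary.Reasoning.Setoid setoid
  open import Algebra.Solver.CommutativeMonoid *-commutativeMonoid using (solve; _⊜_; _⊕_)

  module _ (m : Subset n → Carrier) (q qi : Carrier) (v vi : Fin n → Carrier) where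
    r f t s : Fin n → Bool
    r i = lookup R i
    f i = lookup F i
    t i = lookup T i
    s i = lookup S i

    c₀ : Carrier
    c₀ = pow qi (rk R)

    pK pL : Subset n → Carrier
    pK Kₛ = prodOver Kₛ (λ e → q * vi e + 1#)
    pL L  = prodOver L (λ e → v e + 1#)

    U : Subset n → Fin n → Carrier
    U A i = lhs-weight (r i) (f i) (s i) qi (v i) (lookup A i)

    W : Fin n → Bool → Bool → Bool → Carrier
    W i = rhs-weight (r i) (f i) (t i) (s i) q qi (v i) (vi i)

    W-at : Subset n → Subset n → Subset n → Fin n → Carrier
    W-at Kₛ L A i = W i (lookup Kₛ i) (lookup L i) (lookup A i)

    W-marginal : Subset n → Fin n → Carrier
    W-marginal A i = (W i false false (lookup A i) + W i false true (lookup A i))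
                     + (W i true false (lookup A i) + W i true true (lookup A i))

    qi^rk : ∀ {A} → R ⊆ A → A ⊆ S → pow qi (rk A) ≈ c₀ * ∏ (λ i → qi ^ᵇ (lookup A i ∧ f i))
    qi^rk {A} R⊆A A⊆S = begin
      pow qi (rk A)
        ≡⟨ ≡.cong (pow qi) (rk-formula R⊆A A⊆S) ⟩
      pow qi (rk R ℕ.+ ∣ A ∩ F ∣)
        ≈⟨ pow-+ qi (rk R) _ ⟩
      c₀ * pow qi ∣ A ∩ F ∣
        ≈⟨ *-congˡ (pow-∣∣ qi (A ∩ F)) ⟩
      c₀ * ∏ (λ i → qi ^ᵇ lookup (A ∩ F) i)
        ≈⟨ *-congˡ (∏-cong {n} λ i → reflexive (≡.cong (qi ^ᵇ_) (lookup-zipWith _∧_ i A F))) ⟩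
      c₀ * ∏ (λ i → qi ^ᵇ (lookup A i ∧ f i)) ∎

    lhs-cube : lhsSum rk m qi v R S ≈ c₀ * ∑ₛ (λ A → ∏ (U A) * m A)
    lhs-cube = begin
      sumL (interval R S) (λ A → m A * pow qi (rk A) * prodOver A v)
        ≈⟨ sumL-interval R S summand ⟩
      ∑ₛ (λ A → ∏ (bRS A) * (c₀ * ((∏ (qiAF A) * ∏ (vA A)) * m A)))
        ≈⟨ ∑ₛ-cong {n} (λ A → trans (regroup _ _ _ _ _) (*-congˡ (*-congʳ (merge A)))) ⟩
      ∑ₛ (λ A → c₀ * (∏ (U A) * m A))
        ≈⟨ sumL-distribˡ c₀ (allSubsets n) _ ⟨
      c₀ * ∑ₛ (λ A → ∏ (U A) * m A) ∎
      where
      bRS qiAF vA : Subset n → Fin n → Carrier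
      bRS A i  = between (r i) (s i) (lookup A i)
      qiAF A i = qi ^ᵇ (lookup A i ∧ f i)
      vA A i   = v i ^ᵇ lookup A i
      summand : ∀ A → R ⊆ A → A ⊆ S → m A * pow qi (rk A) * prodOver A v ≈ c₀ * ((∏ (qiAF A) * ∏ (vA A)) * m A)
      summand A R⊆A A⊆S = begin
        m A * pow qi (rk A) * prodOver A v
          ≈⟨ *-cong (*-congˡ (qi^rk R⊆A A⊆S)) (prodOver-∏ A v) ⟩
        m A * (c₀ * ∏ (qiAF A)) * ∏ (vA A)
          ≈⟨ solve 4 (λ x y z w → (x ⊕ (y ⊕ z)) ⊕ w ⊜ y ⊕ ((z ⊕ w) ⊕ x)) refl (m A) c₀ (∏ (qiAF A)) (∏ (vA A)) ⟩
        c₀ * ((∏ (qiAF A) * ∏ (vA A)) * m A) ∎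
      regroup : ∀ a b x y z → a * (b * ((x * y) * z)) ≈ b * ((a * (x * y)) * z)
      regroup = solve 5 (λ a b x y z → a ⊕ (b ⊕ ((x ⊕ y) ⊕ z)) ⊜ b ⊕ ((a ⊕ (x ⊕ y)) ⊕ z)) refl
      merge : ∀ A → ∏ (bRS A) * (∏ (qiAF A) * ∏ (vA A)) ≈ ∏ (U A)
      merge A = begin
        ∏ (bRS A) * (∏ (qiAF A) * ∏ (vA A))
          ≈⟨ *-congˡ (∏-distrib {n} (qiAF A) (vA A)) ⟨
        ∏ (bRS A) * ∏ (λ i → qiAF A i * vA A i)
          ≈⟨ ∏-distrib {n} (bRS A) _ ⟨
        ∏ (λ i → bRS A i * (qiAF A i * vA A i))
          ≈⟨ ∏-cong {n} (λ i → lhs-weight-product (r i) (f i) (s i) qi (v i) (lookup A i)) ⟩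
        ∏ (U A) ∎

    Q V : Fin n → Carrier
    Q i = qi ^ᵇ (s i ∧ f i)
    V i = v i ^ᵇ (r i ∨ f i)

    bF bT Pk Pl : Subset n → Fin n → Carrier
    bF Kₛ i = between false (f i) (lookup Kₛ i)
    bT L  i = between false (t i) (lookup L i)
    Pk Kₛ i = (q * vi i + 1#) ^ᵇ lookup Kₛ i
    Pl L  i = (v i + 1#) ^ᵇ lookup L i

    ρw : Subset n → Subset n → Subset n → Fin n → Carrier
    ρw Kₛ L A i = ρ-weight (r i ∨ lookup L i) (s i ∧ not (lookup Kₛ i)) (f i) (lookup A i)

    constant : pow qi (rk S) * prodOver (R ∪ F) v ≈ c₀ * (∏ Q * ∏ V)
    constant = begin
      pow qi (rk S) * prodOver (R ∪ F) v
        ≈⟨ *-cong (qi^rk R⊆S ⊆-refl) (prodOver-∏ (R ∪ F) v) ⟩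
      (c₀ * ∏ Q) * ∏ (λ i → v i ^ᵇ lookup (R ∪ F) i)
        ≈⟨ *-congˡ (∏-cong {n} λ i → reflexive (≡.cong (v i ^ᵇ_) (lookup-zipWith _∨_ i R F))) ⟩
      (c₀ * ∏ Q) * ∏ V
        ≈⟨ *-assoc _ _ _ ⟩
      c₀ * (∏ Q * ∏ V) ∎

    ρ-term : ∀ {Kₛ L} → Kₛ ⊆ F → L ⊆ T → ρ rk m (R ∪ L) (S ─ Kₛ) ≈ ∑ₛ (λ A → ∏ (ρw Kₛ L A) * m A)
    ρ-term {Kₛ} {L} K⊆F L⊆T =
      trans (ρ-cube (p⊆p∪q L) (R∪L⊆S─K K⊆F L⊆T) (p─q⊆p S Kₛ) (λ _ _ _ → refl)) (∑ₛ-cong {n} λ A →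
        *-congʳ (∏-cong {n} λ i → reflexive (≡.cong₂ (λ x y → ρ-weight x y (f i) (lookup A i))
          (lookup-zipWith _∨_ i R L) (lookup-─ S Kₛ i))))

    interval-∅ : ∀ (Y : Subset n) {g h : Subset n → Carrier} → (∀ X → X ⊆ Y → g X ≈ h X) →
      sumL (interval ∅ Y) g ≈ ∑ₛ (λ X → ∏ (λ i → between false (lookup Y i) (lookup X i)) * h X)
    interval-∅ Y g≈h = trans (sumL-interval ∅ Y (λ X _ → g≈h X)) (∑ₛ-cong {n} λ X →
      *-congʳ (∏-cong {n} λ i → reflexive (≡.cong (λ b → between b (lookup Y i) (lookup X i)) (lookup-replicate i false))))

    term : ∀ Kₛ L A → (∏ Q * ∏ V) * (∏ (bF Kₛ) * (∏ (bT L) * ((∏ (ρw Kₛ L A) * m A) * ∏ (Pk Kₛ) * ∏ (Pl L))))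
                      ≈ ∏ (W-at Kₛ L A) * m A
    term Kₛ L A = begin
      (∏ Q * ∏ V) * (∏ (bF Kₛ) * (∏ (bT L) * ((∏ (ρw Kₛ L A) * m A) * ∏ (Pk Kₛ) * ∏ (Pl L))))
        ≈⟨ solve 8 (λ q′ v′ k′ l′ ρ′ m′ pk pl → (q′ ⊕ v′) ⊕ (k′ ⊕ (l′ ⊕ (((ρ′ ⊕ m′) ⊕ pk) ⊕ pl)))
                                                ⊜ (k′ ⊕ (l′ ⊕ (ρ′ ⊕ (q′ ⊕ (v′ ⊕ (pk ⊕ pl)))))) ⊕ m′) refl
             (∏ Q) (∏ V) (∏ (bF Kₛ)) (∏ (bT L)) (∏ (ρw Kₛ L A)) (m A) (∏ (Pk Kₛ)) (∏ (Pl L)) ⟩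
      (∏ (bF Kₛ) * (∏ (bT L) * (∏ (ρw Kₛ L A) * (∏ Q * (∏ V * (∏ (Pk Kₛ) * ∏ (Pl L))))))) * m A
        ≈⟨ *-congʳ merge ⟩
      ∏ (W-at Kₛ L A) * m A ∎
      where
      merge : ∏ (bF Kₛ) * (∏ (bT L) * (∏ (ρw Kₛ L A) * (∏ Q * (∏ V * (∏ (Pk Kₛ) * ∏ (Pl L))))))
              ≈ ∏ (W-at Kₛ L A)
      merge = begin
        ∏ (bF Kₛ) * (∏ (bT L) * (∏ (ρw Kₛ L A) * (∏ Q * (∏ V * (∏ (Pk Kₛ) * ∏ (Pl L))))))
          ≈⟨ *-congˡ (*-congˡ (*-congˡ (*-congˡ (*-congˡ (sym (∏-distrib {n} (Pk Kₛ) (Pl L))))))) ⟩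
        ∏ (bF Kₛ) * (∏ (bT L) * (∏ (ρw Kₛ L A) * (∏ Q * (∏ V * ∏ (λ i → Pk Kₛ i * Pl L i)))))
          ≈⟨ *-congˡ (*-congˡ (*-congˡ (*-congˡ (sym (∏-distrib {n} V _))))) ⟩
        ∏ (bF Kₛ) * (∏ (bT L) * (∏ (ρw Kₛ L A) * (∏ Q * ∏ (λ i → V i * (Pk Kₛ i * Pl L i)))))
          ≈⟨ *-congˡ (*-congˡ (*-congˡ (sym (∏-distrib {n} Q _)))) ⟩
        ∏ (bF Kₛ) * (∏ (bT L) * (∏ (ρw Kₛ L A) * ∏ (λ i → Q i * (V i * (Pk Kₛ i * Pl L i)))))
          ≈⟨ *-congˡ (*-congˡ (sym (∏-distrib {n} (ρw Kₛ L A) _))) ⟩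
        ∏ (bF Kₛ) * (∏ (bT L) * ∏ (λ i → ρw Kₛ L A i * (Q i * (V i * (Pk Kₛ i * Pl L i)))))
          ≈⟨ *-congˡ (sym (∏-distrib {n} (bT L) _)) ⟩
        ∏ (bF Kₛ) * ∏ (λ i → bT L i * (ρw Kₛ L A i * (Q i * (V i * (Pk Kₛ i * Pl L i)))))
          ≈⟨ sym (∏-distrib {n} (bF Kₛ) _) ⟩
        ∏ (λ i → bF Kₛ i * (bT L i * (ρw Kₛ L A i * (Q i * (V i * (Pk Kₛ i * Pl L i))))))
          ≈⟨ ∏-cong {n} (λ i → rhs-weight-product (r i) (f i) (t i) (s i) q qi (v i) (vi i)
                                              (lookup Kₛ i) (lookup L i) (lookup A i)) ⟩
        ∏ (W-at Kₛ L A) ∎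

    rhs-cube : pow qi (rk S) * prodOver (R ∪ F) v
                 * sumL (interval ∅ F) (λ Kₛ → sumL (interval ∅ T) (λ L → ρ rk m (R ∪ L) (S ─ Kₛ) * pK Kₛ * pL L))
               ≈ c₀ * ∑ₛ (λ Kₛ → ∑ₛ (λ L → ∑ₛ (λ A → ∏ (W-at Kₛ L A) * m A)))
    rhs-cube = begin
      pow qi (rk S) * prodOver (R ∪ F) v * _
        ≈⟨ *-cong constant double-sum ⟩
      c₀ * QV * ∑ₛ (λ Kₛ → ∏ (bF Kₛ) * ∑ₛ (λ L → ∏ (bT L) * (ΣA Kₛ L * ∏ (Pk Kₛ) * ∏ (Pl L))))
        ≈⟨ *-assoc _ _ _ ⟩
      c₀ * (QV * ∑ₛ (λ Kₛ → ∏ (bF Kₛ) * ∑ₛ (λ L → ∏ (bT L) * (ΣA Kₛ L * ∏ (Pk Kₛ) * ∏ (Pl L)))))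
        ≈⟨ *-congˡ (trans (pull QV) (∑ₛ-cong {n} λ Kₛ → trans (*-congˡ (pull (∏ (bF Kₛ)))) (trans (pull QV)
             (∑ₛ-cong {n} λ L → distribute Kₛ L)))) ⟩
      c₀ * ∑ₛ (λ Kₛ → ∑ₛ (λ L → ∑ₛ (λ A → QV * (∏ (bF Kₛ) * (∏ (bT L) * ((∏ (ρw Kₛ L A) * m A) * ∏ (Pk Kₛ) * ∏ (Pl L)))))))
        ≈⟨ *-congˡ (∑ₛ-cong {n} λ Kₛ → ∑ₛ-cong {n} λ L → ∑ₛ-cong {n} (term Kₛ L)) ⟩
      c₀ * ∑ₛ (λ Kₛ → ∑ₛ (λ L → ∑ₛ (λ A → ∏ (W-at Kₛ L A) * m A))) ∎
      where
      QV : Carrier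
      QV = ∏ Q * ∏ V
      ΣA : Subset n → Subset n → Carrier
      ΣA Kₛ L = ∑ₛ (λ A → ∏ (ρw Kₛ L A) * m A)
      double-sum : sumL (interval ∅ F) (λ Kₛ → sumL (interval ∅ T) (λ L → ρ rk m (R ∪ L) (S ─ Kₛ) * pK Kₛ * pL L))
                   ≈ ∑ₛ (λ Kₛ → ∏ (bF Kₛ) * ∑ₛ (λ L → ∏ (bT L) * (ΣA Kₛ L * ∏ (Pk Kₛ) * ∏ (Pl L))))
      double-sum = interval-∅ F λ Kₛ K⊆F → interval-∅ T λ L L⊆T →
        *-cong (*-cong (ρ-term K⊆F L⊆T) (prodOver-∏ Kₛ _)) (prodOver-∏ L _)
      pull : ∀ x {g : Subset n → Carrier} → x * ∑ₛ g ≈ ∑ₛ (λ X → x * g X)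
      pull x = sumL-distribˡ x (allSubsets n) _
      pull′ : ∀ x {g : Subset n → Carrier} → ∑ₛ g * x ≈ ∑ₛ (λ X → g X * x)
      pull′ x = sumL-distribʳ x (allSubsets n) _
      distribute : ∀ Kₛ L → QV * (∏ (bF Kₛ) * (∏ (bT L) * (ΣA Kₛ L * ∏ (Pk Kₛ) * ∏ (Pl L))))
        ≈ ∑ₛ (λ A → QV * (∏ (bF Kₛ) * (∏ (bT L) * ((∏ (ρw Kₛ L A) * m A) * ∏ (Pk Kₛ) * ∏ (Pl L)))))
      distribute Kₛ L = begin
        QV * (∏ (bF Kₛ) * (∏ (bT L) * (ΣA Kₛ L * ∏ (Pk Kₛ) * ∏ (Pl L))))
          ≈⟨ *-congˡ (*-congˡ (*-congˡ (trans (*-congʳ (pull′ (∏ (Pk Kₛ)))) (pull′ (∏ (Pl L)))))) ⟩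
        QV * (∏ (bF Kₛ) * (∏ (bT L) * ∑ₛ (λ A → (∏ (ρw Kₛ L A) * m A) * ∏ (Pk Kₛ) * ∏ (Pl L))))
          ≈⟨ *-congˡ (*-congˡ (pull (∏ (bT L)))) ⟩
        QV * (∏ (bF Kₛ) * ∑ₛ (λ A → ∏ (bT L) * ((∏ (ρw Kₛ L A) * m A) * ∏ (Pk Kₛ) * ∏ (Pl L))))
          ≈⟨ *-congˡ (pull (∏ (bF Kₛ))) ⟩
        QV * ∑ₛ (λ A → ∏ (bF Kₛ) * (∏ (bT L) * ((∏ (ρw Kₛ L A) * m A) * ∏ (Pk Kₛ) * ∏ (Pl L))))
          ≈⟨ pull QV ⟩
        ∑ₛ (λ A → QV * (∏ (bF Kₛ) * (∏ (bT L) * ((∏ (ρw Kₛ L A) * m A) * ∏ (Pk Kₛ) * ∏ (Pl L))))) ∎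

    marginal : ∑ₛ (λ Kₛ → ∑ₛ (λ L → ∑ₛ (λ A → ∏ (W-at Kₛ L A) * m A)))
               ≈ ∑ₛ (λ A → ∏ (W-marginal A) * m A)
    marginal = trans (∑ₛ-cong {n} λ Kₛ → ∑ₛ-marginalise (λ i l a → W i (lookup Kₛ i) l a) m)
                     (∑ₛ-marginalise (λ i k a → W i k false a + W i k true a) m)

    identity₁ : q * qi ≈ 1# → (∀ e → v e * vi e ≈ 1#) →
      lhsSum rk m qi v R S
        ≈ pow qi (rk S) * prodOver (R ∪ F) v
          * sumL (interval ∅ F) (λ Kₛ → sumL (interval ∅ T) (λ L → ρ rk m (R ∪ L) (S ─ Kₛ) * pK Kₛ * pL L))
    identity₁ q*qi≈1 v*vi≈1 = begin
      lhsSum rk m qi v R S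
        ≈⟨ lhs-cube ⟩
      c₀ * ∑ₛ (λ A → ∏ (U A) * m A)
        ≈⟨ *-congˡ (∑ₛ-cong {n} λ A → *-congʳ (∏-cong {n} (coordinate A))) ⟨
      c₀ * ∑ₛ (λ A → ∏ (W-marginal A) * m A)
        ≈⟨ *-congˡ marginal ⟨
      c₀ * ∑ₛ (λ Kₛ → ∑ₛ (λ L → ∑ₛ (λ A → ∏ (W-at Kₛ L A) * m A)))
        ≈⟨ rhs-cube ⟨
      pow qi (rk S) * prodOver (R ∪ F) v
        * sumL (interval ∅ F) (λ Kₛ → sumL (interval ∅ T) (λ L → ρ rk m (R ∪ L) (S ─ Kₛ) * pK Kₛ * pL L)) ∎
      where
      coordinate : ∀ A i → W-marginal A i ≈ U A i
      coordinate A i = trans (coordinate-identity₁ (role-at i) q qi (v i) (vi i) (lookup A i))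
        (scaleBy-unit (f i ∧ not (lookup A i)) _ (trans (*-cong q*qi≈1 (v*vi≈1 i)) (*-identityˡ 1#)))

-- The quasi-arithmetic case

ℤ-ring : CommutativeRing 0ℓ 0ℓ
ℤ-ring = ℤP.+-*-commutativeRing

module _ where
  open FiniteSums ℤ-ring using (𝟙)
  open CoordinateWeights ℤ-ring using (ρ-weight)

  coordinate-identity₂ : ∀ {r f t s k l} → Role r f t s → k ≤ f → l ≤ t → ∀ x y →
    ρ-weight (r ∨ l) (s ∧ not k) f false ℤ.* (𝟙 ⌊ x ≟ᵇ r ∨ (false ∧ f) ⌋ ℤ.* 𝟙 ⌊ y ≟ᵇ r ∨ (false ∧ t) ⌋)
      ℤ.+ ρ-weight (r ∨ l) (s ∧ not k) f true ℤ.* (𝟙 ⌊ x ≟ᵇ r ∨ (true ∧ f) ⌋ ℤ.* 𝟙 ⌊ y ≟ᵇ r ∨ (true ∧ t) ⌋)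
    ≡ ρ-weight r (r ∨ (f ∧ not k)) f x ℤ.* ρ-weight (r ∨ l) (r ∨ t) f y
  coordinate-identity₂ ∈R b≤b b≤b = λ where
    false false → ≡.refl ; false true → ≡.refl ; true false → ≡.refl ; true true → ≡.refl
  coordinate-identity₂ ∈F f≤t b≤b = λ where
    false false → ≡.refl ; false true → ≡.refl ; true false → ≡.refl ; true true → ≡.refl
  coordinate-identity₂ ∈F b≤b b≤b = λ where
    false false → ≡.refl ; false true → ≡.refl ; true false → ≡.refl ; true true → ≡.refl
  coordinate-identity₂ ∈T b≤b f≤t = λ where
    false false → ≡.refl ; false true → ≡.refl ; true false → ≡.refl ; true true → ≡.refl
  coordinate-identity₂ ∈T b≤b b≤b = λ where
    false false → ≡.refl ; false true → ≡.refl ; true false → ≡.refl ; true true → ≡.refl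
  coordinate-identity₂ ∉S b≤b b≤b = λ where
    false false → ≡.refl ; false true → ≡.refl ; true false → ≡.refl ; true true → ≡.refl

module Factorisation {n} (rk : Subset n → ℕ) {R S F T : Subset n} (mol : IsMolecule rk R S F T) (g : Subset n → ℤ)
  (split : ∀ A → R ⊆ A → A ⊆ S → g R ℤ.* g A ≡ g (R ∪ (A ∩ F)) ℤ.* g (R ∪ (A ∩ T))) where
  open CommutativeRing ℤ-ring using (setoid; *-congˡ; *-congʳ)
  open RingOps ℤ-ring
  open FiniteSums ℤ-ring
  open CubeSums ℤ-ring
  open CoordinateWeights ℤ-ring
  open Molecule rk mol
  open MoleculeSums ℤ-ring rk mol
  open import Relation.Binary.Reasoning.Setoid setoid
  open import Algebra.Properties.CommutativeSemigroup ℤP.*-commutativeSemigroup using (interchange)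

  ρ-factorises : ∀ {Kₛ L} → Kₛ ⊆ F → L ⊆ T →
    g R ℤ.* ρ rk g (R ∪ L) (S ─ Kₛ) ≡ ρ rk g R (R ∪ (F ─ Kₛ)) ℤ.* ρ rk g (R ∪ L) (R ∪ T)
  ρ-factorises {Kₛ} {L} K⊆F L⊆T = begin
    g R ℤ.* ρ rk g (R ∪ L) (S ─ Kₛ)
      ≈⟨ ρ-scale rk g (g R) (R ∪ L) (S ─ Kₛ) ⟩
    ρ rk (λ A → g R ℤ.* g A) (R ∪ L) (S ─ Kₛ)
      ≈⟨ ρ-cube (p⊆p∪q L) (R∪L⊆S─K K⊆F L⊆T) (p─q⊆p S Kₛ) (λ A R∪L⊆A A⊆S─K →
           split A (⊆-trans (p⊆p∪q L) R∪L⊆A) (⊆-trans A⊆S─K (p─q⊆p S Kₛ))) ⟩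
    ∑ₛ (λ A → ∏ (λ i → ρ-weight (lookup (R ∪ L) i) (lookup (S ─ Kₛ) i) (f i) (lookup A i))
              ℤ.* (g (α A) ℤ.* g (β A)))
      ≈⟨ ∑ₛ-cong {n} (λ A → *-congʳ (∏-cong {n} λ i → ≡.cong₂ (λ x y → ρ-weight x y (f i) (lookup A i))
           (lookup-zipWith _∨_ i R L) (lookup-─ S Kₛ i))) ⟩
    ∑ₛ (λ A → weight w A ℤ.* (g (α A) ℤ.* g (β A)))
      ≈⟨ ∑ₛ-pushforward w w₁ w₂ α β α′ β′ α-lookup β-lookup
           (λ i → coordinate-identity₂ (role-at i) (⊆⇒lookup-≤ K⊆F i) (⊆⇒lookup-≤ L⊆T i)) (λ X Y → g X ℤ.* g Y) ⟩
    ∑ₛ (λ X → ∑ₛ (λ Y → (weight w₁ X ℤ.* weight w₂ Y) ℤ.* (g X ℤ.* g Y)))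
      ≈⟨ ∑ₛ-cong {n} (λ X → ∑ₛ-cong {n} λ Y → interchange (weight w₁ X) (weight w₂ Y) (g X) (g Y)) ⟩
    ∑ₛ (λ X → ∑ₛ (λ Y → (weight w₁ X ℤ.* g X) ℤ.* (weight w₂ Y ℤ.* g Y)))
      ≈⟨ sumL-product (allSubsets n) (allSubsets n) (λ X → weight w₁ X ℤ.* g X) (λ Y → weight w₂ Y ℤ.* g Y) ⟨
    ∑ₛ (λ X → weight w₁ X ℤ.* g X) ℤ.* ∑ₛ (λ Y → weight w₂ Y ℤ.* g Y)
      ≈⟨ ≡.cong₂ ℤ._*_ (≡.sym first-factor) (≡.sym second-factor) ⟩
    ρ rk g R (R ∪ (F ─ Kₛ)) ℤ.* ρ rk g (R ∪ L) (R ∪ T) ∎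
    where
    r f t s k l : Fin n → Bool
    r i = lookup R i
    f i = lookup F i
    t i = lookup T i
    s i = lookup S i
    k i = lookup Kₛ i
    l i = lookup L i
    w w₁ w₂ : Fin n → Bool → ℤ
    w  i = ρ-weight (r i ∨ l i) (s i ∧ not (k i)) (f i)
    w₁ i = ρ-weight (r i) (r i ∨ (f i ∧ not (k i))) (f i)
    w₂ i = ρ-weight (r i ∨ l i) (r i ∨ t i) (f i)
    α β : Subset n → Subset n
    α A = R ∪ (A ∩ F)
    β A = R ∪ (A ∩ T)
    α′ β′ : Fin n → Bool → Bool
    α′ i a = r i ∨ (a ∧ f i)
    β′ i a = r i ∨ (a ∧ t i)
    α-lookup : ∀ A i → lookup (α A) i ≡ α′ i (lookup A i)
    α-lookup A i = ≡.trans (lookup-zipWith _∨_ i R (A ∩ F)) (≡.cong (r i ∨_) (lookup-zipWith _∧_ i A F))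
    β-lookup : ∀ A i → lookup (β A) i ≡ β′ i (lookup A i)
    β-lookup A i = ≡.trans (lookup-zipWith _∨_ i R (A ∩ T)) (≡.cong (r i ∨_) (lookup-zipWith _∧_ i A T))
    first-factor : ρ rk g R (R ∪ (F ─ Kₛ)) ≡ ∑ₛ (λ X → weight w₁ X ℤ.* g X)
    first-factor =
      ≡.trans (ρ-cube ⊆-refl (p⊆p∪q (F ─ Kₛ)) (∪-least R⊆S (⊆-trans (p─q⊆p F Kₛ) F⊆S)) (λ _ _ _ → ≡.refl))
      (∑ₛ-cong {n} λ X → *-congʳ (∏-cong {n} λ i → ≡.cong (λ y → ρ-weight (r i) y (f i) (lookup X i))
        (≡.trans (lookup-zipWith _∨_ i R (F ─ Kₛ)) (≡.cong (r i ∨_) (lookup-─ F Kₛ i)))))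
    second-factor : ρ rk g (R ∪ L) (R ∪ T) ≡ ∑ₛ (λ Y → weight w₂ Y ℤ.* g Y)
    second-factor =
      ≡.trans (ρ-cube (p⊆p∪q L) (∪-least (p⊆p∪q T) (⊆-trans L⊆T (q⊆p∪q R T))) (∪-least R⊆S T⊆S) (λ _ _ _ → ≡.refl))
      (∑ₛ-cong {n} λ Y → *-congʳ (∏-cong {n} λ i → ≡.cong₂ (λ x y → ρ-weight x y (f i) (lookup Y i))
        (lookup-zipWith _∨_ i R L) (lookup-zipWith _∨_ i R T)))

[k*d]/ℕd≡k : ∀ k d .{{_ : ℕ.NonZero d}} → (k ℤ.* + d) /ℕ d ≡ k
[k*d]/ℕd≡k (+ a)     d = ≡.trans (≡.cong (_/ℕ d) (≡.sym (ℤP.pos-* a d))) (≡.cong +_ (m*n/n≡m a d))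
[k*d]/ℕd≡k -[1+ a ] (ℕ.suc d) with ℕ.suc (d ℕ.+ a ℕ.* ℕ.suc d) ℕ.% ℕ.suc d in eq
... | ℕ.zero  = ≡.cong (λ z → ℤ.- (+ z)) (m*n/n≡m (ℕ.suc a) (ℕ.suc d))
... | ℕ.suc _ = ⊥-elim (ℕP.1+n≢0 (≡.trans (≡.sym eq) (m*n%n≡0 (ℕ.suc a) (ℕ.suc d))))

module _ where
  open RingOps ℤ-ring using (sumL)

  ∣-sumL-filter : ∀ {a p} {X : Set a} {P : Pred X p} (P? : Decidable P) (xs : List X) (f : X → ℤ) {d} →
                  (∀ x → P x → d Signed.∣ f x) → d Signed.∣ sumL (filter P? xs) f
  ∣-sumL-filter P? []       f d∣f = Signed.divides 0ℤ ≡.refl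
  ∣-sumL-filter P? (x ∷ xs) f d∣f with P? x
  ... | yes Px = Signed.∣m∣n⇒∣m+n (d∣f x Px) (∣-sumL-filter P? xs f d∣f)
  ... | no  _  = ∣-sumL-filter P? xs f d∣f

module QuasiArithmetic {n} (rk : Subset n → ℕ) {R S F T : Subset n} (mol : IsMolecule rk R S F T)
  (m : Subset n → ℕ) (m≢0 : ∀ A → ℕ.NonZero (m A)) (A1h : A1 rk m) (A2h : A2 rk m) where
  open RingOps ℤ-ring using (sign)
  open Molecule rk mol

  ρ-divisible : ∀ Kₛ → + m R Signed.∣ ρℤ rk m R (R ∪ (F ─ Kₛ))
  ρ-divisible Kₛ = Signed.∣n⇒∣m*n (sign ∣ tPart rk R R+F─K ∣)
    (∣-sumL-filter (λ A → (R ⊆? A) ×-dec (A ⊆? R+F─K)) (allSubsets n) (λ A → sign (∣ R+F─K ∣ ℕ.∸ ∣ A ∣) ℤ.* + m A)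
      λ A (R⊆A , A⊆R+F─K) → Signed.∣n⇒∣m*n (sign (∣ R+F─K ∣ ℕ.∸ ∣ A ∣))
        (Signed.∣ᵤ⇒∣ (m-divides m A1h A R⊆A (⊆-trans A⊆R+F─K R+F─K⊆R+F))))
    where
    R+F─K : Subset n
    R+F─K = R ∪ (F ─ Kₛ)
    R+F─K⊆R+F : R+F─K ⊆ R ∪ F
    R+F─K⊆R+F = ∪-least (p⊆p∪q F) (⊆-trans (p─q⊆p F Kₛ) (q⊆p∪q R F))

  quotient : Subset n → ℤ
  quotient Kₛ = (ρℤ rk m R (R ∪ (F ─ Kₛ)) /ℕ m R) {{m≢0 R}}

  ρ-quotient : ∀ Kₛ → ρℤ rk m R (R ∪ (F ─ Kₛ)) ≡ quotient Kₛ ℤ.* + m R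
  ρ-quotient Kₛ with ρ-divisible Kₛ
  ... | Signed.divides k ρ≡k*mR = ≡.trans ρ≡k*mR (≡.cong (ℤ._* + m R) (≡.sym
    (≡.trans (≡.cong (λ z → (z /ℕ m R) {{m≢0 R}}) ρ≡k*mR) ([k*d]/ℕd≡k k (m R) {{m≢0 R}}))))

  m-split : ∀ A → R ⊆ A → A ⊆ S → + m R ℤ.* + m A ≡ + m (R ∪ (A ∩ F)) ℤ.* + m (R ∪ (A ∩ T))
  m-split A R⊆A A⊆S = ≡.trans (≡.sym (ℤP.pos-* (m R) (m A)))
    (≡.trans (≡.cong +_ (A2h R A (A ∩ F) (A ∩ T) (restriction R⊆A A⊆S)))
             (ℤP.pos-* (m (R ∪ (A ∩ F))) (m (R ∪ (A ∩ T)))))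

  ρ-splits : ∀ {Kₛ L} → Kₛ ⊆ F → L ⊆ T →
             ρℤ rk m (R ∪ L) (S ─ Kₛ) ≡ quotient Kₛ ℤ.* ρℤ rk m (R ∪ L) (R ∪ T)
  ρ-splits {Kₛ} {L} K⊆F L⊆T = ℤP.*-cancelˡ-≡ (+ m R) _ _ {{m≢0 R}} (begin
    + m R ℤ.* ρℤ rk m (R ∪ L) (S ─ Kₛ)
      ≡⟨ Factorisation.ρ-factorises rk mol (λ A → + m A) m-split K⊆F L⊆T ⟩
    ρℤ rk m R (R ∪ (F ─ Kₛ)) ℤ.* ρℤ rk m (R ∪ L) (R ∪ T)
      ≡⟨ ≡.cong (ℤ._* ρℤ rk m (R ∪ L) (R ∪ T)) (ρ-quotient Kₛ) ⟩
    (quotient Kₛ ℤ.* + m R) ℤ.* ρℤ rk m (R ∪ L) (R ∪ T)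
      ≡⟨ xy∙z≈y∙xz (quotient Kₛ) (+ m R) _ ⟩
    + m R ℤ.* (quotient Kₛ ℤ.* ρℤ rk m (R ∪ L) (R ∪ T)) ∎)
    where
    open ≡.≡-Reasoning
    open import Algebra.Properties.CommutativeSemigroup ℤP.*-commutativeSemigroup using (xy∙z≈y∙xz)

-- From ℤ to an arbitrary commutative ring

module IntegerImage {c ℓ : Level} (K : CommutativeRing c ℓ) where
  open CommutativeRing K hiding (zero)
  open RingOps K
  open FiniteSums K using (sumL-cong)
  open import Relation.Binary.Reasoning.Setoid setoid
  open import Algebra.Properties.Ring ring using (-‿distribʳ-*; -‿distribˡ-*; -0#≈0#; -‿involutive; -‿+-comm)
  open import Algebra.Properties.Semiring.Mult semiring using (×-homo-+; ×1-homo-*) renaming (_×_ to _×ₙ_)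
  module ℤ-Ops = RingOps ℤ-ring

  ιℕ≡×1 : ∀ k → ιℕ k ≡ k ×ₙ 1#
  ιℕ≡×1 ℕ.zero    = ≡.refl
  ιℕ≡×1 (ℕ.suc k) = ≡.cong (λ x → 1# + x) (ιℕ≡×1 k)

  ιℕ-+ : ∀ a b → ιℕ (a ℕ.+ b) ≈ ιℕ a + ιℕ b
  ιℕ-+ a b = begin
    ιℕ (a ℕ.+ b)        ≡⟨ ιℕ≡×1 (a ℕ.+ b) ⟩
    (a ℕ.+ b) ×ₙ 1#      ≈⟨ ×-homo-+ 1# a b ⟩
    a ×ₙ 1# + b ×ₙ 1#     ≡⟨ ≡.cong₂ _+_ (ιℕ≡×1 a) (ιℕ≡×1 b) ⟨
    ιℕ a + ιℕ b         ∎

  ιℕ-* : ∀ a b → ιℕ (a ℕ.* b) ≈ ιℕ a * ιℕ b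
  ιℕ-* a b = begin
    ιℕ (a ℕ.* b)           ≡⟨ ιℕ≡×1 (a ℕ.* b) ⟩
    (a ℕ.* b) ×ₙ 1#         ≈⟨ ×1-homo-* a b ⟩
    (a ×ₙ 1#) * (b ×ₙ 1#)    ≡⟨ ≡.cong₂ _*_ (ιℕ≡×1 a) (ιℕ≡×1 b) ⟨
    ιℕ a * ιℕ b            ∎

  ιℤ-⊖ : ∀ a b → ιℤ (a ⊖ b) ≈ ιℕ a + - ιℕ b
  ιℤ-⊖ a         ℕ.zero    = sym (trans (+-congˡ -0#≈0#) (+-identityʳ _))
  ιℤ-⊖ ℕ.zero    (ℕ.suc b) = sym (+-identityˡ _)
  ιℤ-⊖ (ℕ.suc a) (ℕ.suc b) = begin
    ιℤ (ℕ.suc a ⊖ ℕ.suc b)            ≡⟨ ≡.cong ιℤ (ℤP.[1+m]⊖[1+n]≡m⊖n a b) ⟩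
    ιℤ (a ⊖ b)                         ≈⟨ ιℤ-⊖ a b ⟩
    ιℕ a + - ιℕ b                        ≈⟨ cancel 1# (ιℕ a) (ιℕ b) ⟩
    (1# + ιℕ a) + - (1# + ιℕ b)          ∎
    where
    cancel : ∀ o x y → x + - y ≈ (o + x) + - (o + y)
    cancel o x y = sym (begin
      (o + x) + - (o + y)     ≈⟨ +-congˡ (sym (-‿+-comm o y)) ⟩
      (o + x) + (- o + - y)   ≈⟨ +-congʳ (+-comm o x) ⟩
      (x + o) + (- o + - y)   ≈⟨ +-assoc _ _ _ ⟩
      x + (o + (- o + - y))   ≈⟨ +-congˡ (sym (+-assoc _ _ _)) ⟩
      x + ((o + - o) + - y)   ≈⟨ +-congˡ (+-congʳ (-‿inverseʳ o)) ⟩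
      x + (0# + - y)          ≈⟨ +-congˡ (+-identityˡ _) ⟩
      x + - y                 ∎)

  ιℤ-+ : ∀ i j → ιℤ (i ℤ.+ j) ≈ ιℤ i + ιℤ j
  ιℤ-+ -[1+ a ] -[1+ b ] = begin
    - (1# + (1# + ιℕ (a ℕ.+ b)))       ≈⟨ -‿cong (+-congˡ (+-congˡ (ιℕ-+ a b))) ⟩
    - (1# + (1# + (ιℕ a + ιℕ b)))      ≈⟨ -‿cong (+-congˡ (sym (+-assoc _ _ _))) ⟩
    - (1# + ((1# + ιℕ a) + ιℕ b))      ≈⟨ -‿cong (+-congˡ (+-congʳ (+-comm _ _))) ⟩
    - (1# + ((ιℕ a + 1#) + ιℕ b))      ≈⟨ -‿cong (+-congˡ (+-assoc _ _ _)) ⟩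
    - (1# + (ιℕ a + (1# + ιℕ b)))      ≈⟨ -‿cong (sym (+-assoc _ _ _)) ⟩
    - ((1# + ιℕ a) + (1# + ιℕ b))      ≈⟨ -‿+-comm _ _ ⟨
    - (1# + ιℕ a) + - (1# + ιℕ b)      ∎
  ιℤ-+ -[1+ a ] (+ b)    = trans (ιℤ-⊖ b (ℕ.suc a)) (+-comm _ _)
  ιℤ-+ (+ a)    -[1+ b ] = ιℤ-⊖ a (ℕ.suc b)
  ιℤ-+ (+ a)    (+ b)    = ιℕ-+ a b

  ιℤ-◃⁺ : ∀ k → ιℤ (Sign.+ ℤ.◃ k) ≈ ιℕ k
  ιℤ-◃⁺ ℕ.zero    = refl
  ιℤ-◃⁺ (ℕ.suc k) = refl

  ιℤ-◃⁻ : ∀ k → ιℤ (Sign.- ℤ.◃ k) ≈ - ιℕ k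
  ιℤ-◃⁻ ℕ.zero    = sym -0#≈0#
  ιℤ-◃⁻ (ℕ.suc k) = refl

  ιℤ-* : ∀ i j → ιℤ (i ℤ.* j) ≈ ιℤ i * ιℤ j
  ιℤ-* (+ a)    (+ b)    = trans (ιℤ-◃⁺ (a ℕ.* b)) (ιℕ-* a b)
  ιℤ-* (+ a)    -[1+ b ] =
    trans (ιℤ-◃⁻ (a ℕ.* suc b)) (trans (-‿cong (ιℕ-* a (suc b))) (-‿distribʳ-* _ _))
  ιℤ-* -[1+ a ] (+ b)    =
    trans (ιℤ-◃⁻ (suc a ℕ.* b)) (trans (-‿cong (ιℕ-* (suc a) b)) (-‿distribˡ-* _ _))
  ιℤ-* -[1+ a ] -[1+ b ] =
    trans (ιℤ-◃⁺ (suc a ℕ.* suc b)) (trans (ιℕ-* (suc a) (suc b)) (sym (-x*-y≈x*y _ _)))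
    where
    -x*-y≈x*y : ∀ x y → - x * - y ≈ x * y
    -x*-y≈x*y x y = trans (sym (-‿distribˡ-* x (- y))) (trans (-‿cong (sym (-‿distribʳ-* x y))) (-‿involutive _))

  ιℤ-sumL : ∀ {a} {X : Set a} (xs : List X) (f : X → ℤ) → ιℤ (ℤ-Ops.sumL xs f) ≈ sumL xs (λ x → ιℤ (f x))
  ιℤ-sumL []       f = refl
  ιℤ-sumL (x ∷ xs) f = trans (ιℤ-+ (f x) _) (+-congˡ (ιℤ-sumL xs f))

  ιℤ-sign : ∀ k → ιℤ (ℤ-Ops.sign k) ≈ sign k
  ιℤ-sign ℕ.zero    = +-identityʳ 1#
  ιℤ-sign (ℕ.suc k) = trans (ιℤ-* ℤ.-1ℤ (ℤ-Ops.sign k)) (*-cong (-‿cong (+-identityʳ 1#)) (ιℤ-sign k))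

  ιℤ-ρ : ∀ {n} (rk : Subset n → ℕ) (m : Subset n → ℕ) R S →
         ιℤ (ρℤ rk m R S) ≈ ρ rk (λ A → ιℕ (m A)) R S
  ιℤ-ρ rk m R S = trans (ιℤ-* (ℤ-Ops.sign ∣ tPart rk R S ∣) _) (*-cong (ιℤ-sign ∣ tPart rk R S ∣)
    (trans (ιℤ-sumL (interval R S) (λ A → ℤ-Ops.sign (∣ S ∣ ℕ.∸ ∣ A ∣) ℤ.* + m A))
      (sumL-cong (interval R S) λ A →
        trans (ιℤ-* (ℤ-Ops.sign (∣ S ∣ ℕ.∸ ∣ A ∣)) (+ m A)) (*-congʳ (ιℤ-sign (∣ S ∣ ℕ.∸ ∣ A ∣))))))

module SecondIdentity {c ℓ : Level} (K : CommutativeRing c ℓ) {n} (rk : Subset n → ℕ) {R S F T : Subset n}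
  (mol : IsMolecule rk R S F T) (m : Subset n → ℕ) (m≢0 : ∀ A → NonZero (m A)) (A1h : A1 rk m) (A2h : A2 rk m) where
  open CommutativeRing K hiding (zero)
  open RingOps K
  open FiniteSums K
  open CoordinateWeights K using (sumL-interval-cong)
  open IntegerImage K
  open QuasiArithmetic rk mol m m≢0 A1h A2h
  open FirstIdentity K rk mol using (identity₁)
  open import Relation.Binary.Reasoning.Setoid setoid
  open import Algebra.Properties.CommutativeSemigroup *-commutativeSemigroup using (xy∙z≈xz∙y)

  m′ : Subset n → Carrier
  m′ A = ιℕ (m A)

  ρ-image : ∀ {Kₛ L} → Kₛ ⊆ F → L ⊆ T →
            ρ rk m′ (R ∪ L) (S ─ Kₛ) ≈ ιℤ (quotient Kₛ) * ιℤ (ρℤ rk m (R ∪ L) (R ∪ T))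
  ρ-image {Kₛ} {L} K⊆F L⊆T = begin
    ρ rk m′ (R ∪ L) (S ─ Kₛ)                          ≈⟨ ιℤ-ρ rk m (R ∪ L) (S ─ Kₛ) ⟨
    ιℤ (ρℤ rk m (R ∪ L) (S ─ Kₛ))                     ≡⟨ ≡.cong ιℤ (ρ-splits K⊆F L⊆T) ⟩
    ιℤ (quotient Kₛ ℤ.* ρℤ rk m (R ∪ L) (R ∪ T))      ≈⟨ ιℤ-* (quotient Kₛ) _ ⟩
    ιℤ (quotient Kₛ) * ιℤ (ρℤ rk m (R ∪ L) (R ∪ T))   ∎

  identity₂ : Identities.Identity₂ K rk m R S F T (m≢0 R)
  identity₂ q qi v vi q*qi≈1 v*vi≈1 = begin
    lhsSum rk m′ qi v R S
      ≈⟨ identity₁ m′ q qi v vi q*qi≈1 v*vi≈1 ⟩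
    C * sumL (interval ∅ F) (λ Kₛ → sumL (interval ∅ T) (λ L → ρ rk m′ (R ∪ L) (S ─ Kₛ) * pK Kₛ * pL L))
      ≈⟨ *-congˡ (sumL-interval-cong ∅ F λ Kₛ _ K⊆F → sumL-interval-cong ∅ T λ L _ L⊆T →
           *-congʳ (*-congʳ (ρ-image K⊆F L⊆T))) ⟩
    C * sumL (interval ∅ F) (λ Kₛ → sumL (interval ∅ T) (λ L → (a Kₛ * b L) * pK Kₛ * pL L))
      ≈⟨ *-congˡ (sumL-cong (interval ∅ F) λ Kₛ →
           trans (sumL-cong (interval ∅ T) λ L → separate (a Kₛ) (b L) (pK Kₛ) (pL L))
           (sym (sumL-distribˡ (a Kₛ * pK Kₛ) (interval ∅ T) _))) ⟩
    C * sumL (interval ∅ F) (λ Kₛ → (a Kₛ * pK Kₛ) * sumL (interval ∅ T) (λ L → b L * pL L))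
      ≈⟨ *-congˡ (sumL-distribʳ _ (interval ∅ F) _) ⟨
    C * (sumL (interval ∅ F) (λ Kₛ → a Kₛ * pK Kₛ) * sumL (interval ∅ T) (λ L → b L * pL L))
      ≈⟨ *-assoc _ _ _ ⟨
    C * sumL (interval ∅ F) (λ Kₛ → a Kₛ * pK Kₛ) * sumL (interval ∅ T) (λ L → b L * pL L) ∎
    where
    C : Carrier
    C = pow qi (rk S) * prodOver (R ∪ F) v
    pK pL a b : Subset n → Carrier
    pK Kₛ = prodOver Kₛ (λ e → q * vi e + 1#)
    pL L  = prodOver L (λ e → v e + 1#)
    a Kₛ  = ιℤ (quotient Kₛ)
    b L   = ιℤ (ρℤ rk m (R ∪ L) (R ∪ T))
    separate : ∀ x y z w → (x * y) * z * w ≈ (x * z) * (y * w)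
    separate x y z w = trans (*-congʳ (xy∙z≈xz∙y x y z)) (*-assoc _ _ _)

lemma4p2 : ∀ {c ℓ : Level} (n : ℕ) (M : Matroid n) (R S F T : Subset n) →
    IsMolecule (Matroid.rk M) R S F T →
    ((K : CommutativeRing c ℓ) (m : Subset n → CommutativeRing.Carrier K) →
      Identities.Identity₁ K (Matroid.rk M) m R S F T)
    ×
    ((m : Subset n → ℕ) (mpos : ∀ A → NonZero (m A)) →
      A1 (Matroid.rk M) m → A2 (Matroid.rk M) m →
      (∀ Kₛ → Kₛ ⊆ F → + m R ∣ℤ ρℤ (Matroid.rk M) m R (R ∪ (F ─ Kₛ)))
      ×
      ((K : CommutativeRing c ℓ) → Identities.Identity₂ K (Matroid.rk M) m R S F T (mpos R)))
lemma4p2 n M R S F T mol =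
  (λ K m → FirstIdentity.identity₁ K rk mol m) ,
  (λ m m≢0 A1h A2h → (λ Kₛ _ → Signed.∣⇒∣ᵤ (QuasiArithmetic.ρ-divisible rk mol m m≢0 A1h A2h Kₛ)) ,
                     (λ K → SecondIdentity.identity₂ K rk mol m m≢0 A1h A2h))
  where
  rk : Subset n → ℕ
  rk = Matroid.rk M
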